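{- Let $k$ be a positive even integer with $k\le d$ and let $A=\mathrm{diag}(a_1,\ldots,a_d)$ be complex diagonal. Then \[ \sum_{l=0}^k \frac{(-1)^l}{\binom{k}{l}} \sum_{\substack{S \subseteq [d] \\ | S | = k}} \mathsf{e}_{k-l}(A_S)\, \mathsf{e}_l(A_S) = \sum_{q=0}^{k/2} \mathsf{m}_{2_k^q}(A) \left( \frac{\binom{d-(k-q)}{q}}{\binom{k-q}{q}} \sum_{l=q}^{k-q} \frac{(-1)^l}{\binom{k}{l}} \binom{k-q}{l} \binom{l}{q} \right). \]
   Context: $[d]=\{1,\ldots,d\}$. For $S\subseteq[d]$, $A_S=\mathrm{diag}(a_i:i\in S)$ and $\mathsf{e}_l(\cdot)$ is the $l$-th elementary symmetric polynomial of the diagonal entries ($\mathsf{e}_0=1$). For $0\le q\le k/2$, $2_k^q$ is the partition of $k$ with $q$ parts equal to $2$ and $k-2q$ parts equal to $1$, and $\mathsf{m}_{2_k^q}(A)$ is the monomial symmetric polynomial evaluated at $a_1,\ldots,a_d$. -}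

module Defs where

open import Level using (Level)
open import Function using (_∘_)
open import Algebra.Bundles using (CommutativeRing)
open import Data.Bool using (Bool; true; false; if_then_else_; _∧_)
open import Data.Nat as ℕ using (ℕ; zero; suc; _∸_; _≡ᵇ_)
open import Data.Nat.Combinatorics using (_C_)
open import Data.Nat.ListAction using (sum)
open import Data.Bool.ListAction using (and)
open import Data.Integer using (+_)
open import Data.Rational as ℚ using (ℚ; 0ℚ; 1ℚ)
open import Data.List as List using (List; []; _∷_; [_]; _++_; map; upTo; concatMap; foldr)
open import Data.Vec as Vec using (Vec; []; _∷_; toList)
open import Data.Fin using (Fin)
import Data.Fin as Fin
open import Data.Fin.Subset using (Subset; ∣_∣)

ℕ→ℚ : ℕ → ℚ
ℕ→ℚ n = + n ℚ./ 1

-- 1/n for n ≥ 1 (only ever applied to nonzero binomial coefficients;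
-- the value at 0 is an irrelevant convention)
recip : ℕ → ℚ
recip zero    = 0ℚ
recip (suc n) = + 1 ℚ./ suc n

sign : ℕ → ℚ
sign zero    = 1ℚ
sign (suc l) = ℚ.- sign l

range : ℕ → ℕ → List ℕ
range a b = map (a ℕ.+_) (upTo (suc b ∸ a))

sumℚ : List ℚ → ℚ
sumℚ = foldr ℚ._+_ 0ℚ

lhsCoef : ℕ → ℕ → ℚ
lhsCoef k l = sign l ℚ.* recip (k C l)

rhsCoef : ℕ → ℕ → ℕ → ℚ
rhsCoef d k q =
  (ℕ→ℚ ((d ∸ (k ∸ q)) C q) ℚ.* recip ((k ∸ q) C q)) ℚ.*
  sumℚ (map (λ l → lhsCoef k l ℚ.* ℕ→ℚ ((k ∸ q) C l) ℚ.* ℕ→ℚ (l C q))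
            (range q (k ∸ q)))

allSubsets : ∀ d → List (Subset d)
allSubsets zero    = [ [] ]
allSubsets (suc d) = map (true ∷_) (allSubsets d) ++ map (false ∷_) (allSubsets d)

_⊆ᵇ_ : ∀ {d} → Subset d → Subset d → Bool
[] ⊆ᵇ [] = true
(true  ∷ T) ⊆ᵇ (true  ∷ S) = T ⊆ᵇ S
(true  ∷ T) ⊆ᵇ (false ∷ S) = false
(false ∷ T) ⊆ᵇ (_     ∷ S) = T ⊆ᵇ S

allExps : ∀ d → ℕ → List (Vec ℕ d)
allExps zero    b = [ [] ]
allExps (suc d) b = concatMap (λ j → map (j ∷_) (allExps d b)) (upTo (suc b))

countℕ : ℕ → List ℕ → ℕ
countℕ j xs = List.length (List.filterᵇ (j ≡ᵇ_) xs)

-- α is a rearrangement of the partition λ (padded with zeros), where the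
-- entries of α are known to be ≤ |λ|: every positive value occurs equally often
isRearr : ∀ {d} → List ℕ → Vec ℕ d → Bool
isRearr lam α =
  and (map (λ j → countℕ j (toList α) ≡ᵇ countℕ j lam) (range 1 (sum lam)))

-- the partition 2_k^q : q parts equal to 2 and k-2q parts equal to 1
part2 : ℕ → ℕ → List ℕ
part2 k q = List.replicate q 2 ++ List.replicate (k ∸ (2 ℕ.* q)) 1

module Sym {c ℓ : Level} (R : CommutativeRing c ℓ) where
  open CommutativeRing R

  sumR : List Carrier → Carrier
  sumR = foldr _+_ 0#

  pow : Carrier → ℕ → Carrier
  pow x zero    = 1#
  pow x (suc n) = x * pow x n

  prodSub : ∀ {d} → Subset d → (Fin d → Carrier) → Carrier
  prodSub []          a = 1#
  prodSub (true  ∷ T) a = a Fin.zero * prodSub T (a ∘ Fin.suc)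
  prodSub (false ∷ T) a = prodSub T (a ∘ Fin.suc)

  mono : ∀ {d} → Vec ℕ d → (Fin d → Carrier) → Carrier
  mono []      a = 1#
  mono (e ∷ α) a = pow (a Fin.zero) e * mono α (a ∘ Fin.suc)

  eSub : ∀ {d} → ℕ → Subset d → (Fin d → Carrier) → Carrier
  eSub {d} l S a =
    sumR (map (λ T → if (T ⊆ᵇ S) ∧ (∣ T ∣ ≡ᵇ l) then prodSub T a else 0#)
              (allSubsets d))

  msym : ∀ {d} → List ℕ → (Fin d → Carrier) → Carrier
  msym {d} lam a =
    sumR (map (λ α → if isRearr lam α then mono α a else 0#)
              (allExps d (sum lam)))

  sumSubsetsOfSize : ∀ d → ℕ → (Subset d → Carrier) → Carrier
  sumSubsetsOfSize d k f =
    sumR (map (λ S → if ∣ S ∣ ≡ᵇ k then f S else 0#) (allSubsets d))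

-- Expanding e_{k-l}(A_S) e_l(A_S) turns the left-hand side into a sum over T₁, T₂ ⊆ S ⊆ [d]
-- with |S| = k, |T₁| = k - l, |T₂| = l of Π_{T₁} aᵢ · Π_{T₂} aᵢ.  Such a term only depends on the
-- disjoint pieces X = T₁ ∖ T₂, Y = T₂ ∖ T₁, B = T₁ ∩ T₂ and Z = S ∖ (T₁ ∪ T₂).  Since |S| = k, a
-- nonzero contribution forces |Z| = |B| = q with 2q ≤ k, and the term is a monomial of m_{2_k^q}
-- (squares on B); each such monomial arises from C(k-2q, |Y|) splittings of X ∪ Y and
-- C(d-(k-q), q) choices of Z.  Summing the weights (-1)^l / C(k,l) over l = q + |Y| and using
-- C(k-q, l) C(l, q) = C(k-q, q) C(k-2q, l-q) gives the right-hand coefficients.  All these subset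
-- sums are computed as coefficients of products of one factor per coordinate, by recursion on d.

module Submission where

open import Defs
open import Level using (Level; _⊔_)
open import Algebra.Bundles using (CommutativeRing)
open import Algebra.Morphism.Structures using (module RingMorphisms)
open import Data.Nat using (ℕ; _≤_; _<_; _∸_; _/_)
open import Data.Nat.Divisibility using (_∣_; divides)
open import Data.Rational using (ℚ)
open import Data.Rational.Properties using (+-*-rawRing)
open import Data.List using (map)
open import Data.Fin using (Fin)

import Algebra.Properties.CommutativeSemigroup as CommSemigroupProperties
open import Data.Bool using (Bool; true; false; if_then_else_; _∧_)
open import Data.Bool.Properties using (∧-zeroʳ)
open import Data.Bool.ListAction using (and)
open import Data.Fin.Subset using (Subset; ∣_∣)
open import Data.Integer as ℤ using (+_)
import Data.Integer.Properties as ℤ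
open import Data.List as List using (List; []; _∷_; _++_; applyUpTo; upTo; concatMap; replicate)
import Data.List.Properties as List
open import Data.Nat as ℕ using (zero; suc; z≤n; s≤s; _≡ᵇ_)
open import Data.Nat.Combinatorics using (_C_; nCk+nC[k+1]≡[n+1]C[k+1]; nC1≡n; nCk≡nC[n∸k]; k>n⇒nCk≡0)
open import Data.Nat.DivMod using (m*n/n≡m)
open import Data.Nat.ListAction using (sum)
open import Data.Nat.ListAction.Properties using (sum-++)
import Data.Nat.Properties as ℕ
import Data.Nat.Tactic.RingSolver as ℕ-Solver
import Data.Rational as ℚ
import Data.Rational.Properties as ℚ
open import Data.Rational.Unnormalised as ℚᵘ using (mkℚᵘ; *≡*)
import Data.Rational.Unnormalised.Properties as ℚᵘ
open import Data.Sum using (_⊎_; inj₁; inj₂)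
open import Data.Vec using (Vec; toList) renaming (_∷_ to _∷ᵥ_)
open import Data.Vec.Functional using (Vector; head; tail)
open import Function using (_∘_)
open import Relation.Binary.PropositionalEquality as ≡ using (_≡_)
open import Relation.Nullary using (Dec; yes; no)

ℕ→ℚ-suc : ∀ n → ℕ→ℚ (suc n) ≡ ℚ.1ℚ ℚ.+ ℕ→ℚ n
ℕ→ℚ-suc n = ℚ.toℚᵘ-injective (begin-equality
  ℚ.toℚᵘ (ℕ→ℚ (suc n))                     ≃⟨ ℚ.toℚᵘ-fromℚᵘ (mkℚᵘ (+ suc n) 0) ⟩
  mkℚᵘ (+ suc n) 0                           ≃⟨ *≡* (≡.cong (λ z → (+ 1 ℤ.+ z) ℤ.* + 1) (ℤ.*-identityʳ (+ n))) ⟨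
  mkℚᵘ (+ 1) 0 ℚᵘ.+ mkℚᵘ (+ n) 0
    ≃⟨ ℚᵘ.+-cong (ℚ.toℚᵘ-fromℚᵘ (mkℚᵘ (+ 1) 0)) (ℚ.toℚᵘ-fromℚᵘ (mkℚᵘ (+ n) 0)) ⟨
  ℚ.toℚᵘ ℚ.1ℚ ℚᵘ.+ ℚ.toℚᵘ (ℕ→ℚ n)            ≃⟨ ℚ.toℚᵘ-homo-+ ℚ.1ℚ (ℕ→ℚ n) ⟨
  ℚ.toℚᵘ (ℚ.1ℚ ℚ.+ ℕ→ℚ n)                    ∎)
  where open ℚᵘ.≤-Reasoning

recip-inverse : ∀ n → recip (suc n) ℚ.* ℕ→ℚ (suc n) ≡ ℚ.1ℚ
recip-inverse n = ℚ.toℚᵘ-injective (begin-equality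
  ℚ.toℚᵘ (recip (suc n) ℚ.* ℕ→ℚ (suc n))                 ≃⟨ ℚ.toℚᵘ-homo-* (recip (suc n)) (ℕ→ℚ (suc n)) ⟩
  ℚ.toℚᵘ (recip (suc n)) ℚᵘ.* ℚ.toℚᵘ (ℕ→ℚ (suc n))
    ≃⟨ ℚᵘ.*-cong (ℚ.toℚᵘ-fromℚᵘ (mkℚᵘ (+ 1) n)) (ℚ.toℚᵘ-fromℚᵘ (mkℚᵘ (+ suc n) 0)) ⟩
  mkℚᵘ (+ 1) n ℚᵘ.* mkℚᵘ (+ suc n) 0                      ≃⟨ *≡* (≡.cong +_ (ℕ-Solver.solve (n ∷ []))) ⟩
  ℚ.toℚᵘ ℚ.1ℚ                                             ∎)
  where open ℚᵘ.≤-Reasoning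

k≤n⇒nCk>0 : ∀ {n k} → k ≤ n → 0 < n C k
k≤n⇒nCk>0 {zero}  {zero}  _         = s≤s z≤n
k≤n⇒nCk>0 {suc n} {zero}  _         = s≤s z≤n
k≤n⇒nCk>0 {suc n} {suc k} (s≤s k≤n) =
  ≡.subst (0 <_) (nCk+nC[k+1]≡[n+1]C[k+1] n k) (ℕ.<-≤-trans (k≤n⇒nCk>0 k≤n) (ℕ.m≤m+n _ _))

[k+1]*[n+1]C[k+1]≡[n+1]*nCk : ∀ n k → suc k ℕ.* (suc n C suc k) ≡ suc n ℕ.* (n C k)
[k+1]*[n+1]C[k+1]≡[n+1]*nCk zero    zero    = ≡.refl
[k+1]*[n+1]C[k+1]≡[n+1]*nCk zero    (suc k) = ℕ.*-zeroʳ (suc (suc k))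
[k+1]*[n+1]C[k+1]≡[n+1]*nCk (suc n) zero    =
  ≡.trans (ℕ.*-identityˡ _) (≡.trans (nC1≡n (suc (suc n))) (≡.sym (ℕ.*-identityʳ (suc (suc n)))))
[k+1]*[n+1]C[k+1]≡[n+1]*nCk (suc n) (suc k) = begin
  suc (suc k) ℕ.* (suc (suc n) C suc (suc k))   ≡⟨ ≡.cong (suc (suc k) ℕ.*_) (nCk+nC[k+1]≡[n+1]C[k+1] (suc n) (suc k)) ⟨
  suc (suc k) ℕ.* (X ℕ.+ Y)                     ≡⟨ expand k X Y ⟩
  X ℕ.+ suc k ℕ.* X ℕ.+ suc (suc k) ℕ.* Y
    ≡⟨ ≡.cong₂ (λ u v → X ℕ.+ u ℕ.+ v) ([k+1]*[n+1]C[k+1]≡[n+1]*nCk n k) ([k+1]*[n+1]C[k+1]≡[n+1]*nCk n (suc k)) ⟩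
  X ℕ.+ suc n ℕ.* Z ℕ.+ suc n ℕ.* W            ≡⟨ collect n X Z W ⟩
  X ℕ.+ suc n ℕ.* (Z ℕ.+ W)                     ≡⟨ ≡.cong (λ u → X ℕ.+ suc n ℕ.* u) (nCk+nC[k+1]≡[n+1]C[k+1] n k) ⟩
  suc (suc n) ℕ.* X                             ∎
  where
  open ≡.≡-Reasoning
  expand : ∀ k x y → suc (suc k) ℕ.* (x ℕ.+ y) ≡ x ℕ.+ suc k ℕ.* x ℕ.+ suc (suc k) ℕ.* y
  expand = ℕ-Solver.solve-∀
  collect : ∀ n x z w → x ℕ.+ suc n ℕ.* z ℕ.+ suc n ℕ.* w ≡ x ℕ.+ suc n ℕ.* (z ℕ.+ w)
  collect = ℕ-Solver.solve-∀
  X = suc n C suc k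
  Y = suc n C suc (suc k)
  Z = n C k
  W = n C suc k

nC[q+i]*[q+i]Cq≡nCq*[n∸q]Ci : ∀ n q i → (n C (q ℕ.+ i)) ℕ.* ((q ℕ.+ i) C q) ≡ (n C q) ℕ.* ((n ∸ q) C i)
nC[q+i]*[q+i]Cq≡nCq*[n∸q]Ci n       zero    i = ≡.trans (ℕ.*-identityʳ (n C i)) (≡.sym (ℕ.+-identityʳ (n C i)))
nC[q+i]*[q+i]Cq≡nCq*[n∸q]Ci zero    (suc q) i = ≡.refl
nC[q+i]*[q+i]Cq≡nCq*[n∸q]Ci (suc n) (suc q) i = ℕ.*-cancelˡ-≡ _ _ (suc q) (begin
  suc q ℕ.* (A ℕ.* B)                    ≡⟨ ℕ*.x∙yz≈y∙xz (suc q) A B ⟩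
  A ℕ.* (suc q ℕ.* B)                    ≡⟨ ≡.cong (A ℕ.*_) ([k+1]*[n+1]C[k+1]≡[n+1]*nCk (q ℕ.+ i) q) ⟩
  A ℕ.* (suc (q ℕ.+ i) ℕ.* Q)            ≡⟨ ℕ*.x∙yz≈yx∙z A (suc (q ℕ.+ i)) Q ⟩
  (suc (q ℕ.+ i) ℕ.* A) ℕ.* Q            ≡⟨ ≡.cong (ℕ._* Q) ([k+1]*[n+1]C[k+1]≡[n+1]*nCk n (q ℕ.+ i)) ⟩
  suc n ℕ.* N ℕ.* Q                      ≡⟨ ℕ.*-assoc (suc n) N Q ⟩
  suc n ℕ.* (N ℕ.* Q)                    ≡⟨ ≡.cong (suc n ℕ.*_) (nC[q+i]*[q+i]Cq≡nCq*[n∸q]Ci n q i) ⟩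
  suc n ℕ.* (M ℕ.* D)                    ≡⟨ ℕ.*-assoc (suc n) M D ⟨
  suc n ℕ.* M ℕ.* D                      ≡⟨ ≡.cong (ℕ._* D) ([k+1]*[n+1]C[k+1]≡[n+1]*nCk n q) ⟨
  suc q ℕ.* (suc n C suc q) ℕ.* D        ≡⟨ ℕ.*-assoc (suc q) (suc n C suc q) D ⟩
  suc q ℕ.* ((suc n C suc q) ℕ.* D)      ∎)
  where
  open ≡.≡-Reasoning
  module ℕ* = CommSemigroupProperties ℕ.*-commutativeSemigroup
  A = suc n C suc (q ℕ.+ i)
  B = suc (q ℕ.+ i) C suc q
  N = n C (q ℕ.+ i)
  M = n C q
  Q = (q ℕ.+ i) C q
  D = (n ∸ q) C i

-- There are no T₁, T₂ ⊆ S with |S| = s, |Tᵢ| = tᵢ and |T₁ ∩ T₂| = b.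
Unrealisable : ℕ → ℕ → ℕ → ℕ → Set
Unrealisable s t₁ t₂ b = t₁ < b ⊎ t₂ < b ⊎ s ℕ.+ b < t₁ ℕ.+ t₂

unrealisable-s : ∀ {s t₁ t₂ b} → Unrealisable (suc s) t₁ t₂ b → Unrealisable s t₁ t₂ b
unrealisable-s (inj₁ t₁<b)        = inj₁ t₁<b
unrealisable-s (inj₂ (inj₁ t₂<b)) = inj₂ (inj₁ t₂<b)
unrealisable-s (inj₂ (inj₂ s<t))  = inj₂ (inj₂ (ℕ.<⇒≤ s<t))

unrealisable-st₁ : ∀ {s t₁ t₂ b} → Unrealisable (suc s) (suc t₁) t₂ b → Unrealisable s t₁ t₂ b
unrealisable-st₁ (inj₁ t₁<b)            = inj₁ (ℕ.<⇒≤ t₁<b)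
unrealisable-st₁ (inj₂ (inj₁ t₂<b))     = inj₂ (inj₁ t₂<b)
unrealisable-st₁ (inj₂ (inj₂ (s≤s s<t))) = inj₂ (inj₂ s<t)

unrealisable-st₂ : ∀ {s t₁ t₂ b} → Unrealisable (suc s) t₁ (suc t₂) b → Unrealisable s t₁ t₂ b
unrealisable-st₂ (inj₁ t₁<b)        = inj₁ t₁<b
unrealisable-st₂ (inj₂ (inj₁ t₂<b)) = inj₂ (inj₁ (ℕ.<⇒≤ t₂<b))
unrealisable-st₂ {s} {t₁} {t₂} {b} (inj₂ (inj₂ s<t)) =
  inj₂ (inj₂ (ℕ.s≤s⁻¹ (≡.subst (suc (s ℕ.+ b) <_) (ℕ.+-suc t₁ t₂) s<t)))

unrealisable-st₁t₂b : ∀ {s t₁ t₂ b} → Unrealisable (suc s) (suc t₁) (suc t₂) (suc b) → Unrealisable s t₁ t₂ b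
unrealisable-st₁t₂b (inj₁ (s≤s t₁<b))        = inj₁ t₁<b
unrealisable-st₁t₂b (inj₂ (inj₁ (s≤s t₂<b))) = inj₂ (inj₁ t₂<b)
unrealisable-st₁t₂b {s} {t₁} {t₂} {b} (inj₂ (inj₂ (s≤s s<t))) =
  inj₂ (inj₂ (ℕ.s≤s⁻¹ (≡.subst₂ _<_ (ℕ.+-suc s b) (ℕ.+-suc t₁ t₂) s<t)))

2q≤k⇒k≡q+[k∸2q+q] : ∀ k q → 2 ℕ.* q ≤ k → k ≡ q ℕ.+ ((k ∸ 2 ℕ.* q) ℕ.+ q)
2q≤k⇒k≡q+[k∸2q+q] k q 2q≤k = ≡.trans (≡.sym (ℕ.m+[n∸m]≡n 2q≤k)) (regroup q (k ∸ 2 ℕ.* q))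
  where
  regroup : ∀ q r → 2 ℕ.* q ℕ.+ r ≡ q ℕ.+ (r ℕ.+ q)
  regroup = ℕ-Solver.solve-∀

2q≤k⇒k∸q≡k∸2q+q : ∀ k q → 2 ℕ.* q ≤ k → k ∸ q ≡ (k ∸ 2 ℕ.* q) ℕ.+ q
2q≤k⇒k∸q≡k∸2q+q k q 2q≤k =
  ≡.trans (≡.cong (_∸ q) (2q≤k⇒k≡q+[k∸2q+q] k q 2q≤k)) (ℕ.m+n∸m≡n q ((k ∸ 2 ℕ.* q) ℕ.+ q))

2q≤k⇒q≤k∸q : ∀ k q → 2 ℕ.* q ≤ k → q ≤ k ∸ q
2q≤k⇒q≤k∸q k q 2q≤k = ≡.subst (q ≤_) (≡.sym (2q≤k⇒k∸q≡k∸2q+q k q 2q≤k)) (ℕ.m≤n+m q (k ∸ 2 ℕ.* q))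

k∸q∸q≡k∸2q : ∀ k q → k ∸ q ∸ q ≡ k ∸ 2 ℕ.* q
k∸q∸q≡k∸2q k q = ≡.trans (ℕ.∸-+-assoc k q q) (≡.cong (λ n → k ∸ (q ℕ.+ n)) (≡.sym (ℕ.+-identityʳ q)))

module Halving {k h : ℕ} (k≡h*2 : k ≡ h ℕ.* 2) where

  k/2≡h : k / 2 ≡ h
  k/2≡h = ≡.trans (≡.cong (_/ 2) k≡h*2) (m*n/n≡m h 2)

  h≤k : h ≤ k
  h≤k = ≡.subst (h ≤_) (≡.sym k≡h*2) (ℕ.m≤m*n h 2)

  2q≤k : ∀ {q} → q ≤ h → 2 ℕ.* q ≤ k
  2q≤k {q} q≤h = ≡.subst (2 ℕ.* q ≤_) (≡.trans (ℕ.*-comm 2 h) (≡.sym k≡h*2)) (ℕ.*-monoʳ-≤ 2 q≤h)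

  k<b+b : ∀ {b} → h < b → k < b ℕ.+ b
  k<b+b h<b = ≡.subst (_< _) (≡.trans (h+h≡h*2 h) (≡.sym k≡h*2)) (ℕ.+-mono-< h<b h<b)
    where
    h+h≡h*2 : ∀ h → h ℕ.+ h ≡ h ℕ.* 2
    h+h≡h*2 = ℕ-Solver.solve-∀

  2≤k : 0 < k → 2 ≤ k
  2≤k 0<k = 2q≤k (ℕ.n≢0⇒n>0 (λ h≡0 → ℕ.<-irrefl (≡.sym (≡.trans k≡h*2 (≡.cong (ℕ._* 2) h≡0))) 0<k))

countℕ-cons : ∀ j x xs → countℕ j (x ∷ xs) ≡ (if j ≡ᵇ x then suc (countℕ j xs) else countℕ j xs)
countℕ-cons j x xs with j ≡ᵇ x
... | true  = ≡.refl
... | false = ≡.refl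

countℕ-self : ∀ j xs → countℕ j (j ∷ xs) ≡ suc (countℕ j xs)
countℕ-self j xs = ≡.trans (countℕ-cons j j xs) (≡.cong (λ b → if b then suc (countℕ j xs) else countℕ j xs) (≡ᵇ-refl j))
  where
  ≡ᵇ-refl : ∀ n → (n ≡ᵇ n) ≡ true
  ≡ᵇ-refl zero    = ≡.refl
  ≡ᵇ-refl (suc n) = ≡ᵇ-refl n

countℕ-++ : ∀ j xs ys → countℕ j (xs ++ ys) ≡ countℕ j xs ℕ.+ countℕ j ys
countℕ-++ j xs ys = ≡.trans (≡.cong List.length (List.filter-++ _ xs ys)) (List.length-++ (List.filterᵇ (j ≡ᵇ_) xs))

countℕ-replicate : ∀ j n x → countℕ j (replicate n x) ≡ (if j ≡ᵇ x then n else 0)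
countℕ-replicate j zero    x with j ≡ᵇ x
... | true  = ≡.refl
... | false = ≡.refl
countℕ-replicate j (suc n) x = ≡.trans (countℕ-cons j x (replicate n x)) (step (j ≡ᵇ x) (countℕ-replicate j n x))
  where
  step : ∀ b {c} → c ≡ (if b then n else 0) → (if b then suc c else c) ≡ (if b then suc n else 0)
  step true  eq = ≡.cong suc eq
  step false eq = eq

multiplicity₂₁ : ℕ → ℕ → ℕ → ℕ
multiplicity₂₁ p q 1 = p
multiplicity₂₁ p q 2 = q
multiplicity₂₁ p q _ = 0

countℕ-part2 : ∀ k q j → countℕ j (part2 k q) ≡ multiplicity₂₁ (k ∸ 2 ℕ.* q) q j
countℕ-part2 k q j = begin
  countℕ j (part2 k q)                                        ≡⟨ countℕ-++ j (replicate q 2) (replicate (k ∸ 2 ℕ.* q) 1) ⟩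
  countℕ j (replicate q 2) ℕ.+ countℕ j (replicate (k ∸ 2 ℕ.* q) 1)
    ≡⟨ ≡.cong₂ ℕ._+_ (countℕ-replicate j q 2) (countℕ-replicate j (k ∸ 2 ℕ.* q) 1) ⟩
  (if j ≡ᵇ 2 then q else 0) ℕ.+ (if j ≡ᵇ 1 then k ∸ 2 ℕ.* q else 0)  ≡⟨ cases j ⟩
  multiplicity₂₁ (k ∸ 2 ℕ.* q) q j                            ∎
  where
  open ≡.≡-Reasoning
  cases : ∀ j → (if j ≡ᵇ 2 then q else 0) ℕ.+ (if j ≡ᵇ 1 then k ∸ 2 ℕ.* q else 0) ≡ multiplicity₂₁ (k ∸ 2 ℕ.* q) q j
  cases 0                   = ≡.refl
  cases 1                   = ≡.refl
  cases 2                   = ℕ.+-identityʳ q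
  cases (suc (suc (suc j))) = ≡.refl

sum-part2 : ∀ k q → 2 ℕ.* q ≤ k → sum (part2 k q) ≡ k
sum-part2 k q 2q≤k = begin
  sum (part2 k q)                                        ≡⟨ sum-++ (replicate q 2) (replicate (k ∸ 2 ℕ.* q) 1) ⟩
  sum (replicate q 2) ℕ.+ sum (replicate (k ∸ 2 ℕ.* q) 1)
    ≡⟨ ≡.cong₂ ℕ._+_ (sum-replicate q 2) (≡.trans (sum-replicate (k ∸ 2 ℕ.* q) 1) (ℕ.*-identityʳ _)) ⟩
  q ℕ.* 2 ℕ.+ (k ∸ 2 ℕ.* q)                              ≡⟨ ≡.cong (ℕ._+ (k ∸ 2 ℕ.* q)) (ℕ.*-comm q 2) ⟩
  2 ℕ.* q ℕ.+ (k ∸ 2 ℕ.* q)                              ≡⟨ ℕ.m+[n∸m]≡n 2q≤k ⟩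
  k                                                      ∎
  where
  open ≡.≡-Reasoning
  sum-replicate : ∀ n x → sum (replicate n x) ≡ n ℕ.* x
  sum-replicate zero    x = ≡.refl
  sum-replicate (suc n) x = ≡.cong (x ℕ.+_) (sum-replicate n x)

hasProfile₂₁ : ℕ → ℕ → ℕ → List ℕ → Bool
hasProfile₂₁ p q B xs = and (applyUpTo (λ i → countℕ (suc i) xs ≡ᵇ multiplicity₂₁ p q (suc i)) B)

isRearr-part2 : ∀ k q {d} (α : Vec ℕ d) →
                isRearr (part2 k q) α ≡ hasProfile₂₁ (k ∸ 2 ℕ.* q) q (sum (part2 k q)) (toList α)
isRearr-part2 k q α = ≡.cong and (begin
  map (λ j → countℕ j xs ≡ᵇ countℕ j (part2 k q)) (map suc (upTo B))
    ≡⟨ List.map-cong (λ j → ≡.cong (countℕ j xs ≡ᵇ_) (countℕ-part2 k q j)) (map suc (upTo B)) ⟩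
  map f (map suc (upTo B))   ≡⟨ List.map-∘ (upTo B) ⟨
  map (f ∘ suc) (upTo B)     ≡⟨ List.map-upTo (f ∘ suc) B ⟩
  applyUpTo (f ∘ suc) B      ∎)
  where
  open ≡.≡-Reasoning
  xs = toList α
  B = sum (part2 k q)
  f : ℕ → Bool
  f j = countℕ j xs ≡ᵇ multiplicity₂₁ (k ∸ 2 ℕ.* q) q j

and-applyUpTo-true : ∀ n → and (applyUpTo (λ _ → true) n) ≡ true
and-applyUpTo-true zero    = ≡.refl
and-applyUpTo-true (suc n) = and-applyUpTo-true n

and-applyUpTo-false : ∀ {n} (f : ℕ → Bool) {i} → i < n → f i ≡ false → and (applyUpTo f n) ≡ false
and-applyUpTo-false {suc n} f {zero}  _         fi≡false = ≡.cong (_∧ and (applyUpTo (f ∘ suc) n)) fi≡false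
and-applyUpTo-false {suc n} f {suc i} (s≤s i<n) fi≡false =
  ≡.trans (≡.cong (f 0 ∧_) (and-applyUpTo-false (f ∘ suc) i<n fi≡false)) (∧-zeroʳ (f 0))

module Sums {c ℓ : Level} (R : CommutativeRing c ℓ) where
  open CommutativeRing R hiding (zero)
  open Sym R using (sumR)
  open import Relation.Binary.Reasoning.Setoid setoid
  open CommSemigroupProperties +-commutativeSemigroup using () renaming (interchange to +-interchange)

  sumOver : {A : Set} → (A → Carrier) → List A → Carrier
  sumOver f xs = sumR (map f xs)

  sumTo : ℕ → (ℕ → Carrier) → Carrier
  sumTo n f = sumR (applyUpTo f n)

  -- the coefficient of tⁿ in t · Σₘ f m tᵐ
  atPred : ℕ → (ℕ → Carrier) → Carrier
  atPred zero    f = 0#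
  atPred (suc n) f = f n

  when : Bool → Carrier → Carrier
  when b x = if b then x else 0#

  δ₀ : ℕ → Carrier
  δ₀ zero    = 1#
  δ₀ (suc _) = 0#

  atPred-cong : ∀ n {f g} → (∀ m → f m ≈ g m) → atPred n f ≈ atPred n g
  atPred-cong zero    f≈g = refl
  atPred-cong (suc n) f≈g = f≈g n

  atPred-*ˡ : ∀ n x f → x * atPred n f ≈ atPred n (λ m → x * f m)
  atPred-*ˡ zero    x f = zeroʳ x
  atPred-*ˡ (suc n) x f = refl

  atPred-*ʳ : ∀ n x f → atPred n f * x ≈ atPred n (λ m → f m * x)
  atPred-*ʳ zero    x f = zeroˡ x
  atPred-*ʳ (suc n) x f = refl

  atPred-* : ∀ m n f g → atPred m f * atPred n g ≈ atPred m (λ i → atPred n (λ j → f i * g j))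
  atPred-* m n f g = trans (atPred-*ʳ m (atPred n g) f) (atPred-cong m (λ i → atPred-*ˡ n (f i) g))

  atPred-vanish : ∀ n {f} → (∀ m → suc m ≡ n → f m ≈ 0#) → atPred n f ≈ 0#
  atPred-vanish zero    f≈0 = refl
  atPred-vanish (suc n) f≈0 = f≈0 n ≡.refl

  atPred-≡ : ∀ {n m} f → n ≡ suc m → atPred n f ≈ f m
  atPred-≡ f ≡.refl = refl

  when-0≡ᵇ : ∀ n x → when (0 ≡ᵇ n) x ≈ δ₀ n * x
  when-0≡ᵇ zero    x = sym (*-identityˡ x)
  when-0≡ᵇ (suc n) x = sym (zeroˡ x)

  when-cong : ∀ b {x y} → x ≈ y → when b x ≈ when b y
  when-cong true  x≈y = x≈y
  when-cong false x≈y = refl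

  when-+ : ∀ b x y → when b (x + y) ≈ when b x + when b y
  when-+ true  x y = refl
  when-+ false x y = sym (+-identityˡ 0#)

  when-* : ∀ b x y → when b (x * y) ≈ x * when b y
  when-* true  x y = refl
  when-* false x y = sym (zeroʳ x)

  record Linear (A : Set) : Set (c ⊔ ℓ) where
    field
      apply      : (A → Carrier) → Carrier
      apply-cong : ∀ {f g} → (∀ x → f x ≈ g x) → apply f ≈ apply g
      apply-+    : ∀ f g → apply (λ x → f x + g x) ≈ apply f + apply g
      apply-*    : ∀ y f → apply (λ x → y * f x) ≈ y * apply f

    apply-0 : apply (λ _ → 0#) ≈ 0#
    apply-0 = begin
      apply (λ _ → 0#)        ≈⟨ apply-cong (λ _ → zeroˡ 0#) ⟨
      apply (λ _ → 0# * 0#)   ≈⟨ apply-* 0# (λ _ → 0#) ⟩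
      0# * apply (λ _ → 0#)   ≈⟨ zeroˡ _ ⟩
      0#                      ∎

    apply-vanish : ∀ {f} → (∀ x → f x ≈ 0#) → apply f ≈ 0#
    apply-vanish f≈0 = trans (apply-cong f≈0) apply-0

    apply-combination : ∀ x y f g h k →
      apply (λ z → f z + x * g z + x * h z + y * k z) ≈ apply f + x * apply g + x * apply h + y * apply k
    apply-combination x y f g h k =
      trans (apply-+ _ _) (+-cong (trans (apply-+ _ _) (+-cong (trans (apply-+ _ _) (+-cong refl (apply-* x g))) (apply-* x h))) (apply-* y k))

    apply-atPred : ∀ n (F : ℕ → A → Carrier) → apply (λ x → atPred n (λ m → F m x)) ≈ atPred n (λ m → apply (F m))
    apply-atPred zero    F = apply-0
    apply-atPred (suc n) F = refl

    apply-sumTo : ∀ n (F : ℕ → A → Carrier) → apply (λ x → sumTo n (λ i → F i x)) ≈ sumTo n (λ i → apply (F i))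
    apply-sumTo zero    F = apply-0
    apply-sumTo (suc n) F = trans (apply-+ (F 0) _) (+-cong refl (apply-sumTo n (F ∘ suc)))

    apply-atPred-*ʳ : ∀ n (F : ℕ → A → Carrier) (g : A → Carrier) →
                      apply (λ x → atPred n (λ m → F m x) * g x) ≈ atPred n (λ m → apply (λ x → F m x * g x))
    apply-atPred-*ʳ n F g = trans (apply-cong (λ x → atPred-*ʳ n (g x) (λ m → F m x))) (apply-atPred n (λ m x → F m x * g x))

    apply-atPred-*ˡ : ∀ n (F : ℕ → A → Carrier) (g : A → Carrier) →
                      apply (λ x → g x * atPred n (λ m → F m x)) ≈ atPred n (λ m → apply (λ x → g x * F m x))
    apply-atPred-*ˡ n F g = trans (apply-cong (λ x → atPred-*ˡ n (g x) (λ m → F m x))) (apply-atPred n (λ m x → g x * F m x))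

    apply-atPred-* : ∀ m n (F G : ℕ → A → Carrier) →
                     apply (λ x → atPred m (λ i → F i x) * atPred n (λ j → G j x))
                     ≈ atPred m (λ i → atPred n (λ j → apply (λ x → F i x * G j x)))
    apply-atPred-* m n F G = trans (apply-cong (λ x → atPred-* m n (λ i → F i x) (λ j → G j x)))
      (trans (apply-atPred m (λ i x → atPred n (λ j → F i x * G j x))) (atPred-cong m (λ i → apply-atPred n (λ j x → F i x * G j x))))

    restrict : (A → Bool) → Linear A
    restrict p = record
      { apply      = λ f → apply (λ x → when (p x) (f x))
      ; apply-cong = λ f≈g → apply-cong (λ x → when-cong (p x) (f≈g x))
      ; apply-+    = λ f g → trans (apply-cong (λ x → when-+ (p x) (f x) (g x))) (apply-+ _ _)
      ; apply-*    = λ y f → trans (apply-cong (λ x → when-* (p x) y (f x))) (apply-* y _)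
      }

  sumOver-linear : {A : Set} → List A → Linear A
  sumOver-linear xs = record
    { apply      = λ f → sumOver f xs
    ; apply-cong = cong xs
    ; apply-+    = λ f g → +-homo f g xs
    ; apply-*    = λ y f → *-homo y f xs
    }
    where
    cong : ∀ {A : Set} (xs : List A) {f g} → (∀ x → f x ≈ g x) → sumOver f xs ≈ sumOver g xs
    cong []       f≈g = refl
    cong (x ∷ xs) f≈g = +-cong (f≈g x) (cong xs f≈g)
    +-homo : ∀ {A : Set} (f g : A → Carrier) xs → sumOver (λ x → f x + g x) xs ≈ sumOver f xs + sumOver g xs
    +-homo f g []       = sym (+-identityˡ 0#)
    +-homo f g (x ∷ xs) = trans (+-cong refl (+-homo f g xs)) (+-interchange (f x) (g x) _ _)
    *-homo : ∀ {A : Set} y (f : A → Carrier) xs → sumOver (λ x → y * f x) xs ≈ y * sumOver f xs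
    *-homo y f []       = sym (zeroʳ y)
    *-homo y f (x ∷ xs) = trans (+-cong refl (*-homo y f xs)) (sym (distribˡ y _ _))

  atPred-linear : ℕ → Linear ℕ
  atPred-linear n = record
    { apply      = atPred n
    ; apply-cong = atPred-cong n
    ; apply-+    = +-homo n
    ; apply-*    = λ y f → sym (atPred-*ˡ n y f)
    }
    where
    +-homo : ∀ n f g → atPred n (λ m → f m + g m) ≈ atPred n f + atPred n g
    +-homo zero    f g = sym (+-identityˡ 0#)
    +-homo (suc n) f g = refl

  sumTo-cong< : ∀ n {f g} → (∀ i → i < n → f i ≈ g i) → sumTo n f ≈ sumTo n g
  sumTo-cong< zero    f≈g = refl
  sumTo-cong< (suc n) f≈g = +-cong (f≈g 0 (s≤s z≤n)) (sumTo-cong< n (λ i i<n → f≈g (suc i) (s≤s i<n)))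

  sumTo-linear : ℕ → Linear ℕ
  sumTo-linear n = record
    { apply      = sumTo n
    ; apply-cong = λ f≈g → sumTo-cong< n (λ i _ → f≈g i)
    ; apply-+    = +-homo n
    ; apply-*    = *-homo n
    }
    where
    +-homo : ∀ n f g → sumTo n (λ i → f i + g i) ≈ sumTo n f + sumTo n g
    +-homo zero    f g = sym (+-identityˡ 0#)
    +-homo (suc n) f g = trans (+-cong refl (+-homo n (f ∘ suc) (g ∘ suc))) (+-interchange (f 0) (g 0) _ _)
    *-homo : ∀ n y f → sumTo n (λ i → y * f i) ≈ y * sumTo n f
    *-homo zero    y f = sym (zeroʳ y)
    *-homo (suc n) y f = trans (+-cong refl (*-homo n y (f ∘ suc))) (sym (distribˡ y _ _))

  sumTo-vanish< : ∀ n {f} → (∀ i → i < n → f i ≈ 0#) → sumTo n f ≈ 0#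
  sumTo-vanish< n f≈0 = trans (sumTo-cong< n f≈0) (Linear.apply-0 (sumTo-linear n))

  sumTo-+ : ∀ m n f → sumTo (m ℕ.+ n) f ≈ sumTo m f + sumTo n (λ i → f (m ℕ.+ i))
  sumTo-+ zero    n f = sym (+-identityˡ _)
  sumTo-+ (suc m) n f = trans (+-cong refl (sumTo-+ m n (f ∘ suc))) (sym (+-assoc _ _ _))

  sumTo-atPred : ∀ n f → sumTo (suc n) (λ i → atPred i f) ≈ sumTo n f
  sumTo-atPred n f = +-identityˡ _

  sumTo-dropPrefix : ∀ b n f → (∀ i → i < b → f i ≈ 0#) → sumTo (b ℕ.+ n) f ≈ sumTo n (λ i → f (b ℕ.+ i))
  sumTo-dropPrefix b n f f≈0 = trans (sumTo-+ b n f) (trans (+-cong (sumTo-vanish< b f≈0) refl) (+-identityˡ _))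

  sumTo-dropSuffix : ∀ w r f → (∀ i → i < r → f (w ℕ.+ i) ≈ 0#) → sumTo (w ℕ.+ r) f ≈ sumTo w f
  sumTo-dropSuffix w r f f≈0 = trans (sumTo-+ w r f) (trans (+-cong refl (sumTo-vanish< r f≈0)) (+-identityʳ _))

  sumOver-map : ∀ {A B : Set} (f : B → Carrier) (g : A → B) xs → sumOver f (map g xs) ≡ sumOver (f ∘ g) xs
  sumOver-map f g xs = ≡.cong sumR (≡.sym (List.map-∘ xs))

  sumOver-++ : ∀ {A : Set} (f : A → Carrier) xs ys → sumOver f (xs ++ ys) ≈ sumOver f xs + sumOver f ys
  sumOver-++ f []       ys = sym (+-identityˡ _)
  sumOver-++ f (x ∷ xs) ys = trans (+-cong refl (sumOver-++ f xs ys)) (sym (+-assoc _ _ _))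

  sumOver-concatMap : ∀ {A B : Set} (f : B → Carrier) (g : A → List B) xs →
                      sumOver f (concatMap g xs) ≈ sumOver (λ x → sumOver f (g x)) xs
  sumOver-concatMap f g []       = refl
  sumOver-concatMap f g (x ∷ xs) = trans (sumOver-++ f (g x) (concatMap g xs)) (+-cong refl (sumOver-concatMap f g xs))

  sumOver-range : ∀ f a b → sumOver f (range a b) ≡ sumTo (suc b ∸ a) (λ i → f (a ℕ.+ i))
  sumOver-range f a b = ≡.cong sumR (≡.trans (≡.sym (List.map-∘ (upTo (suc b ∸ a)))) (List.map-upTo _ (suc b ∸ a)))

-- Subset sums as coefficients of products over the coordinates

module SubsetSums {c ℓ : Level} (R : CommutativeRing c ℓ) where
  open CommutativeRing R hiding (zero)
  open Sym R
  open Sums R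
  open import Relation.Binary.Reasoning.Setoid setoid
  open import Algebra.Solver.Ring.NaturalCoefficients.Default commutativeSemiring

  vanishes₁ : ∀ p q → p * (0# * q) ≈ 0#
  vanishes₁ p q = trans (*-cong refl (zeroˡ q)) (zeroʳ p)

  vanishes₂ : ∀ p q r → p * (q * (0# * r)) ≈ 0#
  vanishes₂ p q r = trans (*-cong refl (vanishes₁ q r)) (zeroʳ p)

  vanishes₃ : ∀ p q r → p * (q * (r * 0#)) ≈ 0#
  vanishes₃ p q r = trans (*-cong refl (trans (*-cong refl (zeroʳ r)) (zeroʳ q))) (zeroʳ p)

  sumOver-allSubsets : ∀ {d} (F : Subset (suc d) → Carrier) →
    sumOver F (allSubsets (suc d)) ≈ sumOver (F ∘ (true ∷ᵥ_)) (allSubsets d) + sumOver (F ∘ (false ∷ᵥ_)) (allSubsets d)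
  sumOver-allSubsets {d} F = trans (sumOver-++ F (map (true ∷ᵥ_) (allSubsets d)) _)
    (+-cong (reflexive (sumOver-map F _ (allSubsets d))) (reflexive (sumOver-map F _ (allSubsets d))))

  eSub-true : ∀ {d} t (S : Subset d) a → eSub t (true ∷ᵥ S) a ≈ head a * atPred t (λ u → eSub u S (tail a)) + eSub t S (tail a)
  eSub-true {d} t S a =
    trans (sumOver-allSubsets (λ T → when ((T ⊆ᵇ (true ∷ᵥ S)) ∧ (∣ T ∣ ≡ᵇ t)) (prodSub T a))) (+-cong (containingHead t) refl)
    where
    open Linear (sumOver-linear (allSubsets d))
    containingHead : ∀ t → sumOver (λ T → when ((T ⊆ᵇ S) ∧ (suc ∣ T ∣ ≡ᵇ t)) (head a * prodSub T (tail a))) (allSubsets d)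
                           ≈ head a * atPred t (λ u → eSub u S (tail a))
    containingHead zero    = trans (apply-vanish (λ T → reflexive (≡.cong (λ b → when b _) (∧-zeroʳ (T ⊆ᵇ S))))) (sym (zeroʳ _))
    containingHead (suc u) = Linear.apply-* (restrict (λ T → (T ⊆ᵇ S) ∧ (∣ T ∣ ≡ᵇ u))) (head a) _

  eSub-false : ∀ {d} t (S : Subset d) a → eSub t (false ∷ᵥ S) a ≈ eSub t S (tail a)
  eSub-false {d} t S a =
    trans (sumOver-allSubsets (λ T → when ((T ⊆ᵇ (false ∷ᵥ S)) ∧ (∣ T ∣ ≡ᵇ t)) (prodSub T a)))
      (trans (+-cong (Linear.apply-0 (sumOver-linear (allSubsets d))) refl) (+-identityˡ _))

  ePairSum : ∀ d → ℕ → ℕ → ℕ → Vector Carrier d → Carrier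
  ePairSum d s t₁ t₂ a = sumSubsetsOfSize d s (λ S → eSub t₁ S a * eSub t₂ S a)

  ePairSum-suc : ∀ d s t₁ t₂ (a : Vector Carrier (suc d)) →
    let x = head a
        H = λ s t₁ t₂ → ePairSum d s t₁ t₂ (tail a)
    in ePairSum (suc d) s t₁ t₂ a
       ≈ H s t₁ t₂ + atPred s (λ s' → H s' t₁ t₂ + x * atPred t₁ (λ u → H s' u t₂) + x * atPred t₂ (λ v → H s' t₁ v)
                                      + (x * x) * atPred t₁ (λ u → atPred t₂ (λ v → H s' u v)))
  ePairSum-suc d s t₁ t₂ a =
    trans (sumOver-allSubsets (λ S → when (∣ S ∣ ≡ᵇ s) (eSub t₁ S a * eSub t₂ S a)))
      (trans (+-cong (containingHead s) notContainingHead) (+-comm _ _))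
    where
    x = head a
    e : ℕ → Subset d → Carrier
    e t S = eSub t S (tail a)
    notContainingHead : sumOver (λ S → when (∣ S ∣ ≡ᵇ s) (eSub t₁ (false ∷ᵥ S) a * eSub t₂ (false ∷ᵥ S) a)) (allSubsets d)
                        ≈ ePairSum d s t₁ t₂ (tail a)
    notContainingHead = Linear.apply-cong (sumOver-linear (allSubsets d))
      (λ S → when-cong (∣ S ∣ ≡ᵇ s) (*-cong (eSub-false t₁ S a) (eSub-false t₂ S a)))
    expand : ∀ p₁ e₁ p₂ e₂ →
             (x * p₁ + e₁) * (x * p₂ + e₂) ≈ e₁ * e₂ + x * (p₁ * e₂) + x * (e₁ * p₂) + (x * x) * (p₁ * p₂)
    expand = solve 5 (λ x p₁ e₁ p₂ e₂ → (x :* p₁ :+ e₁) :* (x :* p₂ :+ e₂)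
                                        := e₁ :* e₂ :+ x :* (p₁ :* e₂) :+ x :* (e₁ :* p₂) :+ (x :* x) :* (p₁ :* p₂)) refl x
    containingHead : ∀ s → sumOver (λ S → when (suc ∣ S ∣ ≡ᵇ s) (eSub t₁ (true ∷ᵥ S) a * eSub t₂ (true ∷ᵥ S) a)) (allSubsets d)
      ≈ atPred s (λ s' → ePairSum d s' t₁ t₂ (tail a) + x * atPred t₁ (λ u → ePairSum d s' u t₂ (tail a))
                         + x * atPred t₂ (λ v → ePairSum d s' t₁ v (tail a))
                         + (x * x) * atPred t₁ (λ u → atPred t₂ (λ v → ePairSum d s' u v (tail a))))
    containingHead zero     = Linear.apply-0 (sumOver-linear (allSubsets d))
    containingHead (suc s') = begin
      apply (λ S → eSub t₁ (true ∷ᵥ S) a * eSub t₂ (true ∷ᵥ S) a)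
        ≈⟨ apply-cong (λ S → trans (*-cong (eSub-true t₁ S a) (eSub-true t₂ S a)) (expand _ _ _ _)) ⟩
      apply (λ S → e t₁ S * e t₂ S + x * (atPred t₁ (λ u → e u S) * e t₂ S) + x * (e t₁ S * atPred t₂ (λ v → e v S))
                   + (x * x) * (atPred t₁ (λ u → e u S) * atPred t₂ (λ v → e v S)))
        ≈⟨ apply-combination x (x * x) _ _ _ _ ⟩
      apply (λ S → e t₁ S * e t₂ S) + x * apply (λ S → atPred t₁ (λ u → e u S) * e t₂ S)
        + x * apply (λ S → e t₁ S * atPred t₂ (λ v → e v S))
        + (x * x) * apply (λ S → atPred t₁ (λ u → e u S) * atPred t₂ (λ v → e v S))
        ≈⟨ +-cong (+-cong (+-cong refl (*-cong refl (apply-atPred-*ʳ t₁ e (e t₂)))) (*-cong refl (apply-atPred-*ˡ t₂ e (e t₁))))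
                  (*-cong refl (apply-atPred-* t₁ t₂ e e)) ⟩
      ePairSum d s' t₁ t₂ (tail a) + x * atPred t₁ (λ u → ePairSum d s' u t₂ (tail a))
        + x * atPred t₂ (λ v → ePairSum d s' t₁ v (tail a)) + (x * x) * atPred t₁ (λ u → atPred t₂ (λ v → ePairSum d s' u v (tail a))) ∎
      where open Linear (Linear.restrict (sumOver-linear (allSubsets d)) (λ S → ∣ S ∣ ≡ᵇ s'))

  -- Σ over T₁, T₂ ⊆ S ⊆ [d] with |S| = s, |Tᵢ| = tᵢ and |T₁ ∩ T₂| = b of Π_{T₁} aᵢ · Π_{T₂} aᵢ
  overlapSum : ∀ d → ℕ → ℕ → ℕ → ℕ → Vector Carrier d → Carrier
  overlapSum zero    s t₁ t₂ b a = δ₀ s * (δ₀ t₁ * (δ₀ t₂ * δ₀ b))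
  overlapSum (suc d) s t₁ t₂ b a =
    G s t₁ t₂ b + atPred s (λ s' → G s' t₁ t₂ b + x * atPred t₁ (λ u → G s' u t₂ b) + x * atPred t₂ (λ v → G s' t₁ v b)
                                   + (x * x) * atPred t₁ (λ u → atPred t₂ (λ v → atPred b (G s' u v))))
    where
    x = head a
    G = λ s t₁ t₂ b → overlapSum d s t₁ t₂ b (tail a)

  sumTo-overlapSum-suc : ∀ d N s t₁ t₂ (a : Vector Carrier (suc d)) →
    let x = head a
        G = λ M s t₁ t₂ → sumTo M (λ b → overlapSum d s t₁ t₂ b (tail a))
    in sumTo (suc N) (λ b → overlapSum (suc d) s t₁ t₂ b a)
       ≈ G (suc N) s t₁ t₂ + atPred s (λ s' → G (suc N) s' t₁ t₂ + x * atPred t₁ (λ u → G (suc N) s' u t₂)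
                                              + x * atPred t₂ (λ v → G (suc N) s' t₁ v)
                                              + (x * x) * atPred t₁ (λ u → atPred t₂ (λ v → G N s' u v)))
  sumTo-overlapSum-suc d N s t₁ t₂ a =
    trans (apply-+ (λ b → G s t₁ t₂ b) (λ b → atPred s (λ s' → F s' b)))
      (+-cong refl (trans (apply-atPred s F) (atPred-cong s inner)))
    where
    open Linear (sumTo-linear (suc N))
    x = head a
    G = λ s t₁ t₂ b → overlapSum d s t₁ t₂ b (tail a)
    F : ℕ → ℕ → Carrier
    F s' b = G s' t₁ t₂ b + x * atPred t₁ (λ u → G s' u t₂ b) + x * atPred t₂ (λ v → G s' t₁ v b)
             + (x * x) * atPred t₁ (λ u → atPred t₂ (λ v → atPred b (G s' u v)))
    inner : ∀ s' → apply (F s')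
            ≈ apply (G s' t₁ t₂) + x * atPred t₁ (λ u → apply (G s' u t₂)) + x * atPred t₂ (λ v → apply (G s' t₁ v))
              + (x * x) * atPred t₁ (λ u → atPred t₂ (λ v → sumTo N (G s' u v)))
    inner s' = trans (apply-combination x (x * x) (G s' t₁ t₂) (λ b → atPred t₁ (λ u → G s' u t₂ b))
                                        (λ b → atPred t₂ (λ v → G s' t₁ v b))
                                        (λ b → atPred t₁ (λ u → atPred t₂ (λ v → atPred b (G s' u v)))))
      (+-cong (+-cong (+-cong refl (*-cong refl (apply-atPred t₁ (λ u → G s' u t₂))))
                      (*-cong refl (apply-atPred t₂ (λ v → G s' t₁ v))))
              (*-cong refl (trans (apply-atPred t₁ (λ u b → atPred t₂ (λ v → atPred b (G s' u v))))
                 (atPred-cong t₁ (λ u → trans (apply-atPred t₂ (λ v b → atPred b (G s' u v)))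
                   (atPred-cong t₂ (λ v → sumTo-atPred N (G s' u v))))))))

  ePairSum≈sumTo-overlapSum : ∀ d N → d ≤ N → ∀ s t₁ t₂ (a : Vector Carrier d) →
                              ePairSum d s t₁ t₂ a ≈ sumTo (suc N) (λ b → overlapSum d s t₁ t₂ b a)
  ePairSum≈sumTo-overlapSum zero N _ s t₁ t₂ a = begin
    when (0 ≡ᵇ s) ((when (0 ≡ᵇ t₁) 1# + 0#) * (when (0 ≡ᵇ t₂) 1# + 0#)) + 0#
      ≈⟨ +-cong (trans (when-0≡ᵇ s _) (*-cong refl (*-cong (+-cong (when-0≡ᵇ t₁ 1#) refl) (+-cong (when-0≡ᵇ t₂ 1#) refl)))) refl ⟩
    δ₀ s * ((δ₀ t₁ * 1# + 0#) * (δ₀ t₂ * 1# + 0#)) + 0#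
      ≈⟨ solve 3 (λ z x y → z :* ((x :* con 1 :+ con 0) :* (y :* con 1 :+ con 0)) :+ con 0
                            := z :* (x :* (y :* con 1)) :+ con 0) refl (δ₀ s) (δ₀ t₁) (δ₀ t₂) ⟩
    δ₀ s * (δ₀ t₁ * (δ₀ t₂ * 1#)) + 0#
      ≈⟨ +-cong refl (sym (sumTo-vanish< N (λ _ _ → vanishes₃ (δ₀ s) (δ₀ t₁) (δ₀ t₂)))) ⟩
    sumTo (suc N) (λ b → overlapSum zero s t₁ t₂ b a) ∎
  ePairSum≈sumTo-overlapSum (suc d) (suc N) (s≤s d≤N) s t₁ t₂ a = begin
    ePairSum (suc d) s t₁ t₂ a
      ≈⟨ ePairSum-suc d s t₁ t₂ a ⟩
    H s t₁ t₂ + atPred s (λ s' → H s' t₁ t₂ + x * atPred t₁ (λ u → H s' u t₂) + x * atPred t₂ (λ v → H s' t₁ v)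
                                 + (x * x) * atPred t₁ (λ u → atPred t₂ (λ v → H s' u v)))
      ≈⟨ +-cong (IH _ _ _) (atPred-cong s (λ s' →
           +-cong (+-cong (+-cong (IH _ _ _) (*-cong refl (atPred-cong t₁ (λ u → IH _ _ _)))) (*-cong refl (atPred-cong t₂ (λ v → IH _ _ _))))
                  (*-cong refl (atPred-cong t₁ (λ u → atPred-cong t₂ (λ v → ePairSum≈sumTo-overlapSum d N d≤N s' u v (tail a))))))) ⟩
    G (suc (suc N)) s t₁ t₂ + atPred s (λ s' → G (suc (suc N)) s' t₁ t₂ + x * atPred t₁ (λ u → G (suc (suc N)) s' u t₂)
                                               + x * atPred t₂ (λ v → G (suc (suc N)) s' t₁ v)
                                               + (x * x) * atPred t₁ (λ u → atPred t₂ (λ v → G (suc N) s' u v)))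
      ≈⟨ sumTo-overlapSum-suc d (suc N) s t₁ t₂ a ⟨
    sumTo (suc (suc N)) (λ b → overlapSum (suc d) s t₁ t₂ b a) ∎
    where
    x = head a
    H = λ s t₁ t₂ → ePairSum d s t₁ t₂ (tail a)
    G = λ M s t₁ t₂ → sumTo M (λ b → overlapSum d s t₁ t₂ b (tail a))
    IH : ∀ s t₁ t₂ → H s t₁ t₂ ≈ G (suc (suc N)) s t₁ t₂
    IH s t₁ t₂ = ePairSum≈sumTo-overlapSum d (suc N) (ℕ.m≤n⇒m≤1+n d≤N) s t₁ t₂ (tail a)

  overlapSum-vanish : ∀ d s t₁ t₂ b (a : Vector Carrier d) → Unrealisable s t₁ t₂ b → overlapSum d s t₁ t₂ b a ≈ 0#
  overlapSum-vanish zero s t₁       t₂       (suc b) a _ = vanishes₃ _ _ _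
  overlapSum-vanish zero s (suc t₁) t₂       zero    a _ = vanishes₁ _ _
  overlapSum-vanish zero s zero     (suc t₂) zero    a _ = vanishes₂ _ _ _
  overlapSum-vanish zero s zero zero zero a (inj₂ (inj₂ ()))
  overlapSum-vanish (suc d) s t₁ t₂ b a unrealisable =
    trans (+-cong (overlapSum-vanish d s t₁ t₂ b (tail a) unrealisable)
                  (atPred-vanish s (λ s' eq → headTerms s' (≡.subst (λ s → Unrealisable s t₁ t₂ b) (≡.sym eq) unrealisable))))
      (+-identityˡ 0#)
    where
    x = head a
    G = λ s t₁ t₂ b → overlapSum d s t₁ t₂ b (tail a)
    headTerms : ∀ s' → Unrealisable (suc s') t₁ t₂ b →
                G s' t₁ t₂ b + x * atPred t₁ (λ u → G s' u t₂ b) + x * atPred t₂ (λ v → G s' t₁ v b)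
                + (x * x) * atPred t₁ (λ u → atPred t₂ (λ v → atPred b (G s' u v))) ≈ 0#
    headTerms s' u = trans
      (+-cong (+-cong (+-cong (overlapSum-vanish d s' t₁ t₂ b (tail a) (unrealisable-s u))
                              (*-cong refl (dropT₁ t₁ u)))
                      (*-cong refl (dropT₂ t₂ u)))
              (*-cong refl (dropAll t₁ t₂ b u)))
      (solve 2 (λ x y → con 0 :+ x :* con 0 :+ x :* con 0 :+ y :* con 0 := con 0) refl x (x * x))
      where
      dropT₁ : ∀ t₁ → Unrealisable (suc s') t₁ t₂ b → atPred t₁ (λ u → G s' u t₂ b) ≈ 0#
      dropT₁ zero     _ = refl
      dropT₁ (suc t₁) u = overlapSum-vanish d s' t₁ t₂ b (tail a) (unrealisable-st₁ u)
      dropT₂ : ∀ t₂ → Unrealisable (suc s') t₁ t₂ b → atPred t₂ (λ v → G s' t₁ v b) ≈ 0#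
      dropT₂ zero     _ = refl
      dropT₂ (suc t₂) u = overlapSum-vanish d s' t₁ t₂ b (tail a) (unrealisable-st₂ u)
      dropAll : ∀ t₁ t₂ b → Unrealisable (suc s') t₁ t₂ b → atPred t₁ (λ u → atPred t₂ (λ v → atPred b (G s' u v))) ≈ 0#
      dropAll zero     t₂       b       _ = refl
      dropAll (suc t₁) zero     b       _ = refl
      dropAll (suc t₁) (suc t₂) zero    _ = refl
      dropAll (suc t₁) (suc t₂) (suc b) u = overlapSum-vanish d s' t₁ t₂ b (tail a) (unrealisable-st₁t₂b u)

  -- Σ over disjoint Z, X, Y, B ⊆ [d] with |Z| = z, |X| = x, |Y| = y, |B| = b of Π_X aᵢ · Π_Y aᵢ · Π_B aᵢ²
  blockSum : ∀ d → ℕ → ℕ → ℕ → ℕ → Vector Carrier d → Carrier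
  blockSum zero    z x y b a = δ₀ z * (δ₀ x * (δ₀ y * δ₀ b))
  blockSum (suc d) z x y b a =
    G z x y b + atPred z (λ z' → G z' x y b) + h * atPred x (λ x' → G z x' y b) + h * atPred y (λ y' → G z x y' b)
    + (h * h) * atPred b (G z x y)
    where
    h = head a
    G = λ z x y b → blockSum d z x y b (tail a)

  -- S = Z ⊎ X ⊎ Y ⊎ B, T₁ = X ⊎ B and T₂ = Y ⊎ B.
  overlapSum≈blockSum : ∀ d z x y b (a : Vector Carrier d) →
                        overlapSum d (z ℕ.+ x ℕ.+ y ℕ.+ b) (x ℕ.+ b) (y ℕ.+ b) b a ≈ blockSum d z x y b a
  overlapSum≈blockSum zero z       x       y       (suc b) a = trans (vanishes₃ _ _ _) (sym (vanishes₃ _ _ _))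
  overlapSum≈blockSum zero z       x       (suc y) zero    a = trans (vanishes₂ _ _ _) (sym (vanishes₂ _ _ _))
  overlapSum≈blockSum zero z       (suc x) zero    zero    a = trans (vanishes₁ _ _) (sym (vanishes₁ _ _))
  overlapSum≈blockSum zero (suc z) zero    zero    zero    a = trans (zeroˡ _) (sym (zeroˡ _))
  overlapSum≈blockSum zero zero    zero    zero    zero    a = refl
  overlapSum≈blockSum (suc d) z x y b a =
    trans (+-cong (overlapSum≈blockSum d z x y b (tail a)) (Linear.apply-combination (atPred-linear S) h (h * h) _ _ _ _))
      (trans (+-cong refl (+-cong (+-cong (+-cong (onlyS z) (*-cong refl (withX x))) (*-cong refl (withY y))) (*-cong refl (withB b))))
        (solve 7 (λ g i x p q y w → g :+ (i :+ x :* p :+ x :* q :+ y :* w) := g :+ i :+ x :* p :+ x :* q :+ y :* w) refl _ _ h _ _ (h * h) _))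
    where
    h = head a
    G = λ s t₁ t₂ b → overlapSum d s t₁ t₂ b (tail a)
    S = z ℕ.+ x ℕ.+ y ℕ.+ b
    onlyS : ∀ z → atPred (z ℕ.+ x ℕ.+ y ℕ.+ b) (λ s' → G s' (x ℕ.+ b) (y ℕ.+ b) b) ≈ atPred z (λ z' → blockSum d z' x y b (tail a))
    onlyS zero     = atPred-vanish (x ℕ.+ y ℕ.+ b) (λ s' eq →
      overlapSum-vanish d s' (x ℕ.+ b) (y ℕ.+ b) b (tail a) (inj₂ (inj₂ (ℕ.≤-reflexive (≡.trans (≡.cong (ℕ._+ b) eq) (regroup x y b))))))
      where
      regroup : ∀ x y b → x ℕ.+ y ℕ.+ b ℕ.+ b ≡ x ℕ.+ b ℕ.+ (y ℕ.+ b)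
      regroup = ℕ-Solver.solve-∀
    onlyS (suc z') = overlapSum≈blockSum d z' x y b (tail a)
    withX : ∀ x → atPred (z ℕ.+ x ℕ.+ y ℕ.+ b) (λ s' → atPred (x ℕ.+ b) (λ u → G s' u (y ℕ.+ b) b))
                  ≈ atPred x (λ x' → blockSum d z x' y b (tail a))
    withX zero     = Linear.apply-vanish (atPred-linear (z ℕ.+ 0 ℕ.+ y ℕ.+ b)) (λ s' → atPred-vanish b (λ u eq →
      overlapSum-vanish d s' u (y ℕ.+ b) b (tail a) (inj₁ (≡.subst (u <_) eq (ℕ.n<1+n u)))))
    withX (suc x') = trans (atPred-≡ _ (shift z x' y b)) (overlapSum≈blockSum d z x' y b (tail a))
      where
      shift : ∀ z x y b → z ℕ.+ suc x ℕ.+ y ℕ.+ b ≡ suc (z ℕ.+ x ℕ.+ y ℕ.+ b)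
      shift = ℕ-Solver.solve-∀
    withY : ∀ y → atPred (z ℕ.+ x ℕ.+ y ℕ.+ b) (λ s' → atPred (y ℕ.+ b) (λ v → G s' (x ℕ.+ b) v b))
                  ≈ atPred y (λ y' → blockSum d z x y' b (tail a))
    withY zero     = Linear.apply-vanish (atPred-linear (z ℕ.+ x ℕ.+ 0 ℕ.+ b)) (λ s' → atPred-vanish b (λ v eq →
      overlapSum-vanish d s' (x ℕ.+ b) v b (tail a) (inj₂ (inj₁ (≡.subst (v <_) eq (ℕ.n<1+n v))))))
    withY (suc y') = trans (atPred-≡ _ (shift z x y' b)) (overlapSum≈blockSum d z x y' b (tail a))
      where
      shift : ∀ z x y b → z ℕ.+ x ℕ.+ suc y ℕ.+ b ≡ suc (z ℕ.+ x ℕ.+ y ℕ.+ b)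
      shift = ℕ-Solver.solve-∀
    withB : ∀ b → atPred (z ℕ.+ x ℕ.+ y ℕ.+ b) (λ s' → atPred (x ℕ.+ b) (λ u → atPred (y ℕ.+ b) (λ v → atPred b (G s' u v))))
                  ≈ atPred b (λ b' → blockSum d z x y b' (tail a))
    withB zero     = Linear.apply-vanish (atPred-linear (z ℕ.+ x ℕ.+ y ℕ.+ 0)) (λ s' →
      Linear.apply-vanish (atPred-linear (x ℕ.+ 0)) (λ u → Linear.apply-0 (atPred-linear (y ℕ.+ 0))))
    withB (suc w)  = trans (atPred-≡ _ (shift z x y w)) (trans (atPred-≡ _ (ℕ.+-suc x w))
      (trans (atPred-≡ _ (ℕ.+-suc y w)) (overlapSum≈blockSum d z x y w (tail a))))
      where
      shift : ∀ z x y b → z ℕ.+ x ℕ.+ y ℕ.+ suc b ≡ suc (z ℕ.+ x ℕ.+ y ℕ.+ b)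
      shift = ℕ-Solver.solve-∀

  open import Algebra.Properties.Semiring.Mult semiring using (_×_; ×-homo-+; ×1-homo-*)

  pascal : ∀ n k → (suc n C suc k) × 1# ≈ (n C k) × 1# + (n C suc k) × 1#
  pascal n k = trans (reflexive (≡.cong (_× 1#) (≡.sym (nCk+nC[k+1]≡[n+1]C[k+1] n k)))) (×-homo-+ 1# (n C k) (n C suc k))

  -- Σ over disjoint Z, M, B ⊆ [d] with |Z| = z, |M| = m, |B| = b of Π_M aᵢ · Π_B aᵢ²
  mergedSum : ∀ d → ℕ → ℕ → ℕ → Vector Carrier d → Carrier
  mergedSum zero    z m b a = δ₀ z * (δ₀ m * δ₀ b)
  mergedSum (suc d) z m b a = G z m b + atPred z (λ z' → G z' m b) + h * atPred m (λ m' → G z m' b) + (h * h) * atPred b (G z m)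
    where
    h = head a
    G = λ z m b → mergedSum d z m b (tail a)

  -- Pascal's rule C(x+y, x) = C(x+y-1, x-1) + C(x+y-1, x) in coefficient form.
  atPred-split : ∀ (G : ℕ → Carrier) x y →
                 atPred x (λ x' → ((x' ℕ.+ y) C x') × 1# * G (x' ℕ.+ y)) + atPred y (λ y' → ((x ℕ.+ y') C x) × 1# * G (x ℕ.+ y'))
                 ≈ ((x ℕ.+ y) C x) × 1# * atPred (x ℕ.+ y) G
  atPred-split G zero    zero    = trans (+-identityˡ 0#) (sym (zeroʳ _))
  atPred-split G zero    (suc y) = +-identityˡ _
  atPred-split G (suc x) zero    = begin
    ((x ℕ.+ 0) C x) × 1# * G (x ℕ.+ 0) + 0#                                  ≈⟨ +-identityʳ _ ⟩
    ((x ℕ.+ 0) C x) × 1# * G (x ℕ.+ 0)                                       ≈⟨ *-cong (+-identityʳ _) refl ⟨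
    (((x ℕ.+ 0) C x) × 1# + 0#) * G (x ℕ.+ 0)                                ≈⟨ *-cong (+-cong refl (reflexive (≡.cong (_× 1#) noRoom))) refl ⟨
    (((x ℕ.+ 0) C x) × 1# + ((x ℕ.+ 0) C suc x) × 1#) * G (x ℕ.+ 0)         ≈⟨ *-cong (pascal (x ℕ.+ 0) x) refl ⟨
    (suc (x ℕ.+ 0) C suc x) × 1# * G (x ℕ.+ 0)                               ∎
    where
    noRoom : (x ℕ.+ 0) C suc x ≡ 0
    noRoom = k>n⇒nCk≡0 (s≤s (ℕ.≤-reflexive (ℕ.+-identityʳ x)))
  atPred-split G (suc x) (suc y) = begin
    (n C x) × 1# * G n + (suc (x ℕ.+ y) C suc x) × 1# * G (suc (x ℕ.+ y))
      ≈⟨ +-cong refl (reflexive (≡.cong (λ m → (m C suc x) × 1# * G m) (≡.sym (ℕ.+-suc x y)))) ⟩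
    (n C x) × 1# * G n + (n C suc x) × 1# * G n    ≈⟨ distribʳ _ _ _ ⟨
    ((n C x) × 1# + (n C suc x) × 1#) * G n        ≈⟨ *-cong (pascal n x) refl ⟨
    (suc n C suc x) × 1# * G n                     ∎
    where n = x ℕ.+ suc y

  blockSum≈mergedSum : ∀ d z x y b (a : Vector Carrier d) →
                       blockSum d z x y b a ≈ ((x ℕ.+ y) C x) × 1# * mergedSum d z (x ℕ.+ y) b a
  blockSum≈mergedSum zero z (suc x) y b a = trans (vanishes₁ _ _) (sym (vanishes₂ _ _ _))
  blockSum≈mergedSum zero z zero (suc y) b a = trans (vanishes₂ _ _ _) (sym (vanishes₂ _ _ _))
  blockSum≈mergedSum zero z zero zero b a =
    solve 2 (λ p q → p :* (con 1 :* (con 1 :* q)) := (con 1 :+ con 0) :* (p :* (con 1 :* q))) refl (δ₀ z) (δ₀ b)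
  blockSum≈mergedSum (suc d) z x y b a = begin
    blockSum (suc d) z x y b a
      ≈⟨ +-cong (+-cong (+-cong (+-cong (IH z x y b) (trans (atPred-cong z (λ z' → IH z' x y b)) (sym (atPred-*ˡ z K _))))
                                (*-cong refl (atPred-cong x (λ x' → IH z x' y b))))
                        (*-cong refl (atPred-cong y (λ y' → IH z x y' b))))
                (*-cong refl (trans (atPred-cong b (λ b' → IH z x y b')) (sym (atPred-*ˡ b K _)))) ⟩
    K * A + K * B + h * U + h * V + (h * h) * (K * D)
      ≈⟨ solve 8 (λ K A B U V h h² D → K :* A :+ K :* B :+ h :* U :+ h :* V :+ h² :* (K :* D)
                                    := K :* A :+ K :* B :+ h :* (U :+ V) :+ h² :* (K :* D)) refl K A B U V h (h * h) D ⟩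
    K * A + K * B + h * (U + V) + (h * h) * (K * D)
      ≈⟨ +-cong (+-cong refl (*-cong refl (atPred-split (λ m' → G z m' b) x y))) refl ⟩
    K * A + K * B + h * (K * W) + (h * h) * (K * D)
      ≈⟨ solve 7 (λ K A B h W h² D → K :* A :+ K :* B :+ h :* (K :* W) :+ h² :* (K :* D)
                                  := K :* (A :+ B :+ h :* W :+ h² :* D)) refl K A B h W (h * h) D ⟩
    K * mergedSum (suc d) z m b a ∎
    where
    h = head a
    G = λ z m b → mergedSum d z m b (tail a)
    IH : ∀ z x y b → blockSum d z x y b (tail a) ≈ ((x ℕ.+ y) C x) × 1# * G z (x ℕ.+ y) b
    IH z x y b = blockSum≈mergedSum d z x y b (tail a)
    m = x ℕ.+ y
    K = (m C x) × 1#
    A = G z m b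
    B = atPred z (λ z' → G z' m b)
    U = atPred x (λ x' → ((x' ℕ.+ y) C x') × 1# * G z (x' ℕ.+ y) b)
    V = atPred y (λ y' → ((x ℕ.+ y') C x) × 1# * G z (x ℕ.+ y') b)
    W = atPred m (λ m' → G z m' b)
    D = atPred b (G z m)

  -- m_{2^b 1^m}(a₁, …, a_d): Σ over disjoint M, B ⊆ [d] with |M| = m, |B| = b of Π_M aᵢ · Π_B aᵢ²
  msym₂₁ : ∀ d → ℕ → ℕ → Vector Carrier d → Carrier
  msym₂₁ zero    m b a = δ₀ m * δ₀ b
  msym₂₁ (suc d) m b a = G m b + h * atPred m (λ m' → G m' b) + (h * h) * atPred b (G m)
    where
    h = head a
    G = λ m b → msym₂₁ d m b (tail a)

  msym₂₁-vanish : ∀ d m b (a : Vector Carrier d) → d < m ℕ.+ b → msym₂₁ d m b a ≈ 0#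
  msym₂₁-vanish zero    (suc m) b       a _ = zeroˡ _
  msym₂₁-vanish zero    zero    (suc b) a _ = zeroʳ _
  msym₂₁-vanish (suc d) m       b       a d<m+b = trans
    (+-cong (+-cong (msym₂₁-vanish d m b (tail a) (ℕ.<-trans (ℕ.n<1+n d) d<m+b)) (*-cong refl (withM m d<m+b)))
            (*-cong refl (withB b d<m+b)))
    (solve 2 (λ x y → con 0 :+ x :* con 0 :+ y :* con 0 := con 0) refl (head a) (head a * head a))
    where
    withM : ∀ m → suc d < m ℕ.+ b → atPred m (λ m' → msym₂₁ d m' b (tail a)) ≈ 0#
    withM zero     _         = refl
    withM (suc m') d<m+b     = msym₂₁-vanish d m' b (tail a) (ℕ.s≤s⁻¹ d<m+b)
    withB : ∀ b → suc d < m ℕ.+ b → atPred b (λ b' → msym₂₁ d m b' (tail a)) ≈ 0#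
    withB zero     _         = refl
    withB (suc b') d<m+b     = msym₂₁-vanish d m b' (tail a) (ℕ.s≤s⁻¹ (≡.subst (suc d <_) (ℕ.+-suc m b') d<m+b))

  0Ck : ∀ k → (0 C k) × 1# ≈ δ₀ k
  0Ck zero    = +-identityʳ 1#
  0Ck (suc k) = refl

  pascal-atPred : ∀ n k → (suc n C k) × 1# ≈ (n C k) × 1# + atPred k (λ k' → (n C k') × 1#)
  pascal-atPred n zero    = sym (+-identityʳ _)
  pascal-atPred n (suc k) = trans (pascal n k) (+-comm _ _)

  mergedSum≈msym₂₁ : ∀ d z m b (a : Vector Carrier d) →
                     mergedSum d z m b a ≈ ((d ∸ (m ℕ.+ b)) C z) × 1# * msym₂₁ d m b a
  mergedSum≈msym₂₁ zero z m b a =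
    *-cong (trans (sym (0Ck z)) (reflexive (≡.cong (λ n → (n C z) × 1#) (≡.sym (ℕ.0∸n≡0 (m ℕ.+ b)))))) refl
  mergedSum≈msym₂₁ (suc d) z m b a = begin
    mergedSum (suc d) z m b a
      ≈⟨ +-cong (+-cong (+-cong (IH z m b) (trans (atPred-cong z (λ z' → IH z' m b)) (sym (atPred-*ʳ z M _))))
                        (*-cong refl (atPred-cong m (λ m' → IH z m' b))))
                (*-cong refl (atPred-cong b (λ b' → IH z m b'))) ⟩
    (e C z) × 1# * M + atPred z (λ z' → (e C z') × 1#) * M
      + h * atPred m (λ m' → ((d ∸ (m' ℕ.+ b)) C z) × 1# * G m' b) + (h * h) * atPred b (λ b' → ((d ∸ (m ℕ.+ b')) C z) × 1# * G m b')
      ≈⟨ +-cong (+-cong (growZ (m ℕ.+ b ℕ.≤? d)) (*-cong refl (growM m))) (*-cong refl (growB b)) ⟩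
    K * M + h * (K * atPred m (λ m' → G m' b)) + (h * h) * (K * atPred b (G m))
      ≈⟨ solve 6 (λ K M h Pm h² Pb → K :* M :+ h :* (K :* Pm) :+ h² :* (K :* Pb) := K :* (M :+ h :* Pm :+ h² :* Pb))
                 refl K M h (atPred m (λ m' → G m' b)) (h * h) (atPred b (G m)) ⟩
    K * msym₂₁ (suc d) m b a ∎
    where
    h = head a
    G = λ m b → msym₂₁ d m b (tail a)
    IH : ∀ z m b → mergedSum d z m b (tail a) ≈ ((d ∸ (m ℕ.+ b)) C z) × 1# * G m b
    IH z m b = mergedSum≈msym₂₁ d z m b (tail a)
    e = d ∸ (m ℕ.+ b)
    M = G m b
    K = ((suc d ∸ (m ℕ.+ b)) C z) × 1#
    growZ : Dec (m ℕ.+ b ≤ d) → (e C z) × 1# * M + atPred z (λ z' → (e C z') × 1#) * M ≈ K * M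
    growZ (yes m+b≤d) = trans (sym (distribʳ M _ _))
      (*-cong (trans (sym (pascal-atPred e z)) (reflexive (≡.cong (λ n → (n C z) × 1#) (≡.sym (ℕ.+-∸-assoc 1 m+b≤d))))) refl)
    growZ (no m+b≰d)  = trans (sym (distribʳ M _ _)) (trans (*-cong refl M≈0) (trans (zeroʳ _) (sym (trans (*-cong refl M≈0) (zeroʳ _)))))
      where
      M≈0 : M ≈ 0#
      M≈0 = msym₂₁-vanish d m b (tail a) (ℕ.≰⇒> m+b≰d)
    growM : ∀ m → atPred m (λ m' → ((d ∸ (m' ℕ.+ b)) C z) × 1# * G m' b) ≈ ((suc d ∸ (m ℕ.+ b)) C z) × 1# * atPred m (λ m' → G m' b)
    growM zero     = sym (zeroʳ _)
    growM (suc m') = refl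
    growB : ∀ b → atPred b (λ b' → ((d ∸ (m ℕ.+ b')) C z) × 1# * G m b') ≈ ((suc d ∸ (m ℕ.+ b)) C z) × 1# * atPred b (G m)
    growB zero     = sym (zeroʳ _)
    growB (suc b') = *-cong (reflexive (≡.cong (λ n → ((suc d ∸ n) C z) × 1#) (≡.sym (ℕ.+-suc m b')))) refl

  profileSum : ∀ d → ℕ → ℕ → ℕ → Vector Carrier d → Carrier
  profileSum d B p q a = sumOver (λ α → when (hasProfile₂₁ p q B (toList α)) (mono α a)) (allExps d B)

  -- Exponents ≥ 3 violate the profile, so only the first three branches of allExps contribute.
  profileSum≈msym₂₁ : ∀ d B p q (a : Vector Carrier d) → profileSum d (2 ℕ.+ B) p q a ≈ msym₂₁ d p q a
  profileSum≈msym₂₁ zero B zero    zero    a =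
    trans (+-cong (reflexive (≡.cong (λ b → when b 1#) (and-applyUpTo-true B))) refl) (trans (+-identityʳ 1#) (sym (*-identityˡ 1#)))
  profileSum≈msym₂₁ zero B (suc p) q       a = trans (+-identityʳ 0#) (sym (zeroˡ _))
  profileSum≈msym₂₁ zero B zero    (suc q) a = trans (+-identityʳ 0#) (sym (zeroʳ _))
  profileSum≈msym₂₁ (suc d) B p q a = begin
    sumOver (F p q) (concatMap (λ j → map (j ∷ᵥ_) X) (upTo (3 ℕ.+ B)))
      ≈⟨ sumOver-concatMap (F p q) (λ j → map (j ∷ᵥ_) X) (upTo (3 ℕ.+ B)) ⟩
    sumOver (λ j → sumOver (F p q) (map (j ∷ᵥ_) X)) (upTo (3 ℕ.+ B))
      ≈⟨ Linear.apply-cong (sumOver-linear (upTo (3 ℕ.+ B))) (λ j → reflexive (sumOver-map (F p q) (j ∷ᵥ_) X)) ⟩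
    sumOver (withHead p q) (upTo (3 ℕ.+ B))
      ≈⟨ reflexive (≡.cong sumR (List.map-upTo (withHead p q) (3 ℕ.+ B))) ⟩
    withHead p q 0 + (withHead p q 1 + (withHead p q 2 + sumTo B (λ i → withHead p q (3 ℕ.+ i))))
      ≈⟨ +-cong head0 (+-cong (head1 p) (+-cong (head2 q) head≥3)) ⟩
    G p q + (h * atPred p (λ p' → G p' q) + ((h * h) * atPred q (G p) + 0#))
      ≈⟨ solve 5 (λ A x P y Q → A :+ (x :* P :+ (y :* Q :+ con 0)) := A :+ x :* P :+ y :* Q)
                 refl (G p q) h (atPred p (λ p' → G p' q)) (h * h) (atPred q (G p)) ⟩
    msym₂₁ (suc d) p q a ∎
    where
    h = head a
    G = λ p q → msym₂₁ d p q (tail a)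
    X = allExps d (2 ℕ.+ B)
    F : ℕ → ℕ → Vec ℕ (suc d) → Carrier
    F p q α = when (hasProfile₂₁ p q (2 ℕ.+ B) (toList α)) (mono α a)
    withHead : ℕ → ℕ → ℕ → Carrier
    withHead p q j = sumOver (λ α → F p q (j ∷ᵥ α)) X
    restricted : ℕ → ℕ → Linear (Vec ℕ d)
    restricted p q = Linear.restrict (sumOver-linear X) (λ α → hasProfile₂₁ p q (2 ℕ.+ B) (toList α))
    head0 : withHead p q 0 ≈ G p q
    head0 = trans (Linear.apply-cong (restricted p q) (λ α → *-identityˡ _)) (profileSum≈msym₂₁ d B p q (tail a))
    head1 : ∀ p → withHead p q 1 ≈ h * atPred p (λ p' → G p' q)
    head1 zero     = trans (Linear.apply-0 (sumOver-linear X)) (sym (zeroʳ h))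
    head1 (suc p') = trans (Linear.apply-cong (restricted p' q) (λ α → *-cong (*-identityʳ h) refl))
      (trans (Linear.apply-* (restricted p' q) h (λ α → mono α (tail a))) (*-cong refl (profileSum≈msym₂₁ d B p' q (tail a))))
    head2 : ∀ q → withHead p q 2 ≈ (h * h) * atPred q (G p)
    head2 zero     = trans (Linear.apply-vanish (sumOver-linear X)
                             (λ α → reflexive (≡.cong (λ b → when b _) (∧-zeroʳ (countℕ 1 (toList α) ≡ᵇ p)))))
                           (sym (zeroʳ _))
    head2 (suc q') = trans (Linear.apply-cong (restricted p q') (λ α → *-cong (*-cong refl (*-identityʳ h)) refl))
      (trans (Linear.apply-* (restricted p q') (h * h) (λ α → mono α (tail a))) (*-cong refl (profileSum≈msym₂₁ d B p q' (tail a))))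
    head≥3 : sumTo B (λ i → withHead p q (3 ℕ.+ i)) ≈ 0#
    head≥3 = sumTo-vanish< B (λ i i<B → Linear.apply-vanish (sumOver-linear X) (λ α → reflexive (≡.cong (λ b → when b _)
      (and-applyUpTo-false (λ j → countℕ (suc j) ((3 ℕ.+ i) ∷ toList α) ≡ᵇ multiplicity₂₁ p q (suc j)) (s≤s (s≤s i<B))
        (≡.cong (ℕ._≡ᵇ 0) (countℕ-self (3 ℕ.+ i) (toList α)))))))

  msym-part2≈msym₂₁ : ∀ {d} k q (a : Vector Carrier d) → 2 ℕ.* q ≤ k → 2 ≤ k →
                      msym (part2 k q) a ≈ msym₂₁ d (k ∸ 2 ℕ.* q) q a
  msym-part2≈msym₂₁ {d} k@(suc (suc k')) q a 2q≤k (s≤s (s≤s z≤n)) =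
    trans (Linear.apply-cong (sumOver-linear (allExps d (sum (part2 k q))))
                             (λ α → reflexive (≡.cong (λ b → when b (mono α a)) (isRearr-part2 k q α))))
      (trans (reflexive (≡.cong (λ B → profileSum d B (k ∸ 2 ℕ.* q) q a) (sum-part2 k q 2q≤k)))
             (profileSum≈msym₂₁ d k' (k ∸ 2 ℕ.* q) q a))

  overlapSum≈msym₂₁ : ∀ d z x y b (a : Vector Carrier d) →
    overlapSum d (z ℕ.+ x ℕ.+ y ℕ.+ b) (x ℕ.+ b) (y ℕ.+ b) b a
    ≈ ((x ℕ.+ y) C x) × 1# * (((d ∸ (x ℕ.+ y ℕ.+ b)) C z) × 1# * msym₂₁ d (x ℕ.+ y) b a)
  overlapSum≈msym₂₁ d z x y b a = trans (overlapSum≈blockSum d z x y b a)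
    (trans (blockSum≈mergedSum d z x y b a) (*-cong refl (mergedSum≈msym₂₁ d z (x ℕ.+ y) b a)))

  -- Here |Z| = b, |T₁ ∖ T₂| = j and |T₂ ∖ T₁| = i.
  overlapSum-central : ∀ d b j i (a : Vector Carrier d) →
    let k = b ℕ.+ (j ℕ.+ i ℕ.+ b) in
    overlapSum d k (k ∸ (b ℕ.+ i)) (b ℕ.+ i) b a
    ≈ ((j ℕ.+ i) C i) × 1# * (((d ∸ (j ℕ.+ i ℕ.+ b)) C b) × 1# * msym₂₁ d (j ℕ.+ i) b a)
  overlapSum-central d b j i a = begin
    overlapSum d k (k ∸ (b ℕ.+ i)) (b ℕ.+ i) b a
      ≈⟨ reflexive (≡.cong₂ (λ s t₁ → overlapSum d s t₁ (b ℕ.+ i) b a) (regroup b j i) complement) ⟩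
    overlapSum d (b ℕ.+ j ℕ.+ i ℕ.+ b) (j ℕ.+ b) (b ℕ.+ i) b a
      ≈⟨ reflexive (≡.cong (λ t₂ → overlapSum d (b ℕ.+ j ℕ.+ i ℕ.+ b) (j ℕ.+ b) t₂ b a) (ℕ.+-comm b i)) ⟩
    overlapSum d (b ℕ.+ j ℕ.+ i ℕ.+ b) (j ℕ.+ b) (i ℕ.+ b) b a
      ≈⟨ overlapSum≈msym₂₁ d b j i b a ⟩
    ((j ℕ.+ i) C j) × 1# * (((d ∸ (j ℕ.+ i ℕ.+ b)) C b) × 1# * msym₂₁ d (j ℕ.+ i) b a)
      ≈⟨ *-cong (reflexive (≡.cong (_× 1#) symmetry)) refl ⟩
    ((j ℕ.+ i) C i) × 1# * (((d ∸ (j ℕ.+ i ℕ.+ b)) C b) × 1# * msym₂₁ d (j ℕ.+ i) b a) ∎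
    where
    k = b ℕ.+ (j ℕ.+ i ℕ.+ b)
    regroup : ∀ b j i → b ℕ.+ (j ℕ.+ i ℕ.+ b) ≡ b ℕ.+ j ℕ.+ i ℕ.+ b
    regroup = ℕ-Solver.solve-∀
    split : ∀ b j i → b ℕ.+ (j ℕ.+ i ℕ.+ b) ≡ (b ℕ.+ i) ℕ.+ (j ℕ.+ b)
    split = ℕ-Solver.solve-∀
    complement : k ∸ (b ℕ.+ i) ≡ j ℕ.+ b
    complement = ≡.trans (≡.cong (_∸ (b ℕ.+ i)) (split b j i)) (ℕ.m+n∸m≡n (b ℕ.+ i) (j ℕ.+ b))
    symmetry : (j ℕ.+ i) C j ≡ (j ℕ.+ i) C i
    symmetry = ≡.trans (nCk≡nC[n∸k] (ℕ.m≤m+n j i)) (≡.cong ((j ℕ.+ i) C_) (ℕ.m+n∸m≡n j i))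

module Coefficients {c ℓ : Level} (R : CommutativeRing c ℓ) (ι : ℚ → CommutativeRing.Carrier R)
                    (ι-hom : RingMorphisms.IsRingHomomorphism +-*-rawRing (CommutativeRing.rawRing R) ι) where
  open CommutativeRing R hiding (zero)
  open Sums R
  open RingMorphisms.IsRingHomomorphism ι-hom using (0#-homo; 1#-homo; +-homo; *-homo)
  open import Relation.Binary.Reasoning.Setoid setoid
  open import Algebra.Properties.Semiring.Mult semiring using (_×_; ×1-homo-*)
  open CommSemigroupProperties *-commutativeSemigroup using (x∙yz≈y∙xz)

  ι-ℕ→ℚ : ∀ n → ι (ℕ→ℚ n) ≈ n × 1#
  ι-ℕ→ℚ zero    = 0#-homo
  ι-ℕ→ℚ (suc n) = trans (reflexive (≡.cong ι (ℕ→ℚ-suc n))) (trans (+-homo ℚ.1ℚ (ℕ→ℚ n)) (+-cong 1#-homo (ι-ℕ→ℚ n)))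

  ι-recip-inverse : ∀ n → 0 < n → ι (recip n) * n × 1# ≈ 1#
  ι-recip-inverse (suc n) _ =
    trans (*-cong refl (sym (ι-ℕ→ℚ (suc n)))) (trans (sym (*-homo _ _)) (trans (reflexive (≡.cong ι (recip-inverse n))) 1#-homo))

  ι-sumℚ : ∀ {A : Set} (f : A → ℚ) xs → ι (sumℚ (map f xs)) ≈ sumOver (ι ∘ f) xs
  ι-sumℚ f []       = 0#-homo
  ι-sumℚ f (x ∷ xs) = trans (+-homo (f x) _) (+-cong refl (ι-sumℚ f xs))

  ι-rhsTerm : ∀ k q i →
    ι (lhsCoef k (q ℕ.+ i) ℚ.* ℕ→ℚ ((k ∸ q) C (q ℕ.+ i)) ℚ.* ℕ→ℚ ((q ℕ.+ i) C q))
    ≈ ((k ∸ q) C q) × 1# * (ι (lhsCoef k (q ℕ.+ i)) * ((k ∸ 2 ℕ.* q) C i) × 1#)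
  ι-rhsTerm k q i = begin
    ι (lhsCoef k l ℚ.* ℕ→ℚ N ℚ.* ℕ→ℚ L)     ≈⟨ trans (*-homo _ _) (*-cong (*-homo _ _) refl) ⟩
    ι (lhsCoef k l) * ι (ℕ→ℚ N) * ι (ℕ→ℚ L) ≈⟨ *-cong (*-cong refl (ι-ℕ→ℚ N)) (ι-ℕ→ℚ L) ⟩
    ι (lhsCoef k l) * N × 1# * L × 1#        ≈⟨ *-assoc _ _ _ ⟩
    ι (lhsCoef k l) * (N × 1# * L × 1#)      ≈⟨ *-cong refl (sym (×1-homo-* N L)) ⟩
    ι (lhsCoef k l) * (N ℕ.* L) × 1#         ≈⟨ *-cong refl (reflexive (≡.cong (_× 1#) subsetOfSubset)) ⟩
    ι (lhsCoef k l) * (Q ℕ.* M) × 1#         ≈⟨ *-cong refl (×1-homo-* Q M) ⟩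
    ι (lhsCoef k l) * (Q × 1# * M × 1#)      ≈⟨ x∙yz≈y∙xz _ _ _ ⟩
    Q × 1# * (ι (lhsCoef k l) * M × 1#)      ∎
    where
    l = q ℕ.+ i
    N = (k ∸ q) C l
    L = l C q
    Q = (k ∸ q) C q
    M = (k ∸ 2 ℕ.* q) C i
    subsetOfSubset : N ℕ.* L ≡ Q ℕ.* M
    subsetOfSubset = ≡.trans (nC[q+i]*[q+i]Cq≡nCq*[n∸q]Ci (k ∸ q) q i)
      (≡.cong (λ n → Q ℕ.* (n C i)) (k∸q∸q≡k∸2q k q))

  ι-rhsCoef : ∀ d k q → 2 ℕ.* q ≤ k →
    ι (rhsCoef d k q)
    ≈ ((d ∸ (k ∸ q)) C q) × 1# * sumTo (suc (k ∸ 2 ℕ.* q)) (λ i → ι (lhsCoef k (q ℕ.+ i)) * ((k ∸ 2 ℕ.* q) C i) × 1#)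
  ι-rhsCoef d k q 2q≤k = begin
    ι ((ℕ→ℚ A ℚ.* recip Q) ℚ.* sumℚ (map T (range q (k ∸ q))))
      ≈⟨ trans (*-homo _ _) (*-cong (trans (*-homo _ _) (*-cong (ι-ℕ→ℚ A) refl)) (ι-sumℚ T (range q (k ∸ q)))) ⟩
    (A × 1# * r) * sumOver (ι ∘ T) (range q (k ∸ q))
      ≈⟨ *-cong refl (reflexive (≡.trans (sumOver-range (ι ∘ T) q (k ∸ q))
                                         (≡.cong (λ n → sumTo n (λ i → ι (T (q ℕ.+ i)))) length))) ⟩
    (A × 1# * r) * sumTo (suc m) (λ i → ι (T (q ℕ.+ i)))
      ≈⟨ *-cong refl (trans (Linear.apply-cong (sumTo-linear (suc m)) (ι-rhsTerm k q))
                            (Linear.apply-* (sumTo-linear (suc m)) (Q × 1#) (λ i → ι (lhsCoef k (q ℕ.+ i)) * (m C i) × 1#))) ⟩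
    (A × 1# * r) * (Q × 1# * S)
      ≈⟨ trans (*-assoc _ _ _) (*-cong refl (sym (*-assoc _ _ _))) ⟩
    A × 1# * ((r * Q × 1#) * S)
      ≈⟨ *-cong refl (trans (*-cong (ι-recip-inverse Q (k≤n⇒nCk>0 q≤k∸q)) refl) (*-identityˡ S)) ⟩
    A × 1# * S ∎
    where
    A = (d ∸ (k ∸ q)) C q
    Q = (k ∸ q) C q
    m = k ∸ 2 ℕ.* q
    r = ι (recip Q)
    T : ℕ → ℚ
    T l = lhsCoef k l ℚ.* ℕ→ℚ ((k ∸ q) C l) ℚ.* ℕ→ℚ (l C q)
    S = sumTo (suc m) (λ i → ι (lhsCoef k (q ℕ.+ i)) * (m C i) × 1#)
    q≤k∸q : q ≤ k ∸ q
    q≤k∸q = 2q≤k⇒q≤k∸q k q 2q≤k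
    length : suc (k ∸ q) ∸ q ≡ suc m
    length = ≡.trans (ℕ.+-∸-assoc 1 q≤k∸q) (≡.cong suc (k∸q∸q≡k∸2q k q))

module WeightedOverlap {c ℓ : Level} (R : CommutativeRing c ℓ) (ι : ℚ → CommutativeRing.Carrier R)
                (ι-hom : RingMorphisms.IsRingHomomorphism +-*-rawRing (CommutativeRing.rawRing R) ι) where
  open CommutativeRing R hiding (zero)
  open Sym R
  open Sums R
  open SubsetSums R
  open Coefficients R ι ι-hom
  open import Relation.Binary.Reasoning.Setoid setoid
  open import Algebra.Properties.Semiring.Mult semiring using (_×_)
  open import Algebra.Solver.Ring.NaturalCoefficients.Default commutativeSemiring

  weightedOverlap : ∀ d → ℕ → ℕ → Vector Carrier d → Carrier
  weightedOverlap d k b a = sumTo (suc k) (λ l → ι (lhsCoef k l) * overlapSum d k (k ∸ l) l b a)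

  lhs≈sumTo-weightedOverlap : ∀ d k (a : Vector Carrier d) →
    sumR (map (λ l → ι (lhsCoef k l) * sumSubsetsOfSize d k (λ S → eSub (k ∸ l) S a * eSub l S a)) (range 0 k))
    ≈ sumTo (suc d) (λ b → weightedOverlap d k b a)
  lhs≈sumTo-weightedOverlap d k a = begin
    sumOver (λ l → ι (lhsCoef k l) * ePairSum d k (k ∸ l) l a) (range 0 k)
      ≡⟨ sumOver-range (λ l → ι (lhsCoef k l) * ePairSum d k (k ∸ l) l a) 0 k ⟩
    apply (λ l → ι (lhsCoef k l) * ePairSum d k (k ∸ l) l a)
      ≈⟨ apply-cong (λ l → *-cong (refl {ι (lhsCoef k l)}) (ePairSum≈sumTo-overlapSum d d ℕ.≤-refl k (k ∸ l) l a)) ⟩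
    apply (λ l → ι (lhsCoef k l) * sumTo (suc d) (λ b → overlapSum d k (k ∸ l) l b a))
      ≈⟨ apply-cong (λ l → sym (Linear.apply-* (sumTo-linear (suc d)) (ι (lhsCoef k l)) (λ b → overlapSum d k (k ∸ l) l b a))) ⟩
    apply (λ l → sumTo (suc d) (λ b → ι (lhsCoef k l) * overlapSum d k (k ∸ l) l b a))
      ≈⟨ apply-sumTo (suc d) (λ b l → ι (lhsCoef k l) * overlapSum d k (k ∸ l) l b a) ⟩
    sumTo (suc d) (λ b → weightedOverlap d k b a) ∎
    where open Linear (sumTo-linear (suc k))

  weightedOverlap-vanish : ∀ d k b (a : Vector Carrier d) → k < b ℕ.+ b → weightedOverlap d k b a ≈ 0#
  weightedOverlap-vanish d k b a k<2b = sumTo-vanish< (suc k) (λ l _ → trans (*-cong refl (vanish l (l ℕ.<? b))) (zeroʳ (ι (lhsCoef k l))))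
    where
    vanish : ∀ l → Dec (l < b) → overlapSum d k (k ∸ l) l b a ≈ 0#
    vanish l (yes l<b) = overlapSum-vanish d k (k ∸ l) l b a (inj₂ (inj₁ l<b))
    vanish l (no  l≮b) = overlapSum-vanish d k (k ∸ l) l b a (inj₁ (ℕ.m<n+o⇒m∸n<o k l {{ℕ.>-nonZero (positive b k<2b)}} k<l+b))
      where
      k<l+b : k < l ℕ.+ b
      k<l+b = ℕ.<-≤-trans k<2b (ℕ.+-monoˡ-≤ b (ℕ.≮⇒≥ l≮b))
      positive : ∀ b → k < b ℕ.+ b → 0 < b
      positive (suc b) _ = s≤s z≤n

  weightedOverlap-central : ∀ d m b (a : Vector Carrier d) → let k = b ℕ.+ (m ℕ.+ b) in
    weightedOverlap d k b a
    ≈ msym₂₁ d m b a * (((d ∸ (m ℕ.+ b)) C b) × 1# * sumTo (suc m) (λ i → ι (lhsCoef k (b ℕ.+ i)) * (m C i) × 1#))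
  weightedOverlap-central d m b a = begin
    sumTo (suc k) f                        ≡⟨ ≡.cong (λ n → sumTo n f) (≡.sym (ℕ.+-suc b (m ℕ.+ b))) ⟩
    sumTo (b ℕ.+ (suc m ℕ.+ b)) f          ≈⟨ sumTo-dropPrefix b (suc m ℕ.+ b) f (λ l l<b → vanish l (inj₂ (inj₁ l<b))) ⟩
    sumTo (suc m ℕ.+ b) (λ i → f (b ℕ.+ i))  ≈⟨ sumTo-dropSuffix (suc m) b (λ i → f (b ℕ.+ i))
                                                  (λ j j<b → vanish (b ℕ.+ (suc m ℕ.+ j)) (inj₁ (beyond j j<b))) ⟩
    sumTo (suc m) (λ i → f (b ℕ.+ i))      ≈⟨ sumTo-cong< (suc m) (λ i i<1+m → central i (ℕ.s≤s⁻¹ i<1+m)) ⟩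
    sumTo (suc m) (λ i → Q * T i)          ≈⟨ Linear.apply-* (sumTo-linear (suc m)) Q T ⟩
    Q * sumTo (suc m) T                    ≈⟨ *-assoc _ _ _ ⟩
    E * (M * sumTo (suc m) T)              ≈⟨ x∙yz≈y∙xz E M _ ⟩
    M * (E * sumTo (suc m) T)              ∎
    where
    open CommSemigroupProperties *-commutativeSemigroup using (x∙yz≈y∙xz)
    k = b ℕ.+ (m ℕ.+ b)
    f : ℕ → Carrier
    f l = ι (lhsCoef k l) * overlapSum d k (k ∸ l) l b a
    E = ((d ∸ (m ℕ.+ b)) C b) × 1#
    M = msym₂₁ d m b a
    Q = E * M
    T : ℕ → Carrier
    T i = ι (lhsCoef k (b ℕ.+ i)) * (m C i) × 1#
    vanish : ∀ l → Unrealisable k (k ∸ l) l b → f l ≈ 0#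
    vanish l u = trans (*-cong refl (overlapSum-vanish d k (k ∸ l) l b a u)) (zeroʳ (ι (lhsCoef k l)))
    beyond : ∀ j → j < b → k ∸ (b ℕ.+ (suc m ℕ.+ j)) < b
    beyond j j<b = ℕ.m<n+o⇒m∸n<o k (b ℕ.+ (suc m ℕ.+ j)) {{ℕ.>-nonZero (ℕ.≤-<-trans z≤n j<b)}}
      (≡.subst (k <_) (regroup b m j) (ℕ.m≤m+n (suc k) j))
      where
      regroup : ∀ b m j → suc (b ℕ.+ (m ℕ.+ b)) ℕ.+ j ≡ b ℕ.+ (suc m ℕ.+ j) ℕ.+ b
      regroup = ℕ-Solver.solve-∀
    central : ∀ i → i ≤ m → f (b ℕ.+ i) ≈ Q * T i
    central i i≤m = begin
      ι (lhsCoef k (b ℕ.+ i)) * overlapSum d k (k ∸ (b ℕ.+ i)) (b ℕ.+ i) b a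
        ≈⟨ *-cong refl (≡.subst P (ℕ.m∸n+n≡m i≤m) (overlapSum-central d b (m ∸ i) i a)) ⟩
      ι (lhsCoef k (b ℕ.+ i)) * ((m C i) × 1# * Q)
        ≈⟨ solve 3 (λ c x q → c :* (x :* q) := q :* (c :* x)) refl (ι (lhsCoef k (b ℕ.+ i))) ((m C i) × 1#) Q ⟩
      Q * T i ∎
      where
      P : ℕ → Set ℓ
      P n = overlapSum d (b ℕ.+ (n ℕ.+ b)) ((b ℕ.+ (n ℕ.+ b)) ∸ (b ℕ.+ i)) (b ℕ.+ i) b a
            ≈ (n C i) × 1# * (((d ∸ (n ℕ.+ b)) C b) × 1# * msym₂₁ d n b a)

  weightedOverlap≈rhsTerm : ∀ d k q (a : Vector Carrier d) → 2 ℕ.* q ≤ k → 2 ≤ k →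
                            weightedOverlap d k q a ≈ msym (part2 k q) a * ι (rhsCoef d k q)
  weightedOverlap≈rhsTerm d k q a 2q≤k 2≤k = begin
    weightedOverlap d k q a
      ≈⟨ ≡.subst P (≡.sym (2q≤k⇒k≡q+[k∸2q+q] k q 2q≤k)) (weightedOverlap-central d m q a) ⟩
    msym₂₁ d m q a * (((d ∸ (m ℕ.+ q)) C q) × 1# * S)
      ≈⟨ *-cong (sym (msym-part2≈msym₂₁ k q a 2q≤k 2≤k))
                (trans (reflexive (≡.cong (λ n → ((d ∸ n) C q) × 1# * S) (≡.sym (2q≤k⇒k∸q≡k∸2q+q k q 2q≤k))))
                       (sym (ι-rhsCoef d k q 2q≤k))) ⟩
    msym (part2 k q) a * ι (rhsCoef d k q) ∎
    where
    m = k ∸ 2 ℕ.* q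
    S = sumTo (suc m) (λ i → ι (lhsCoef k (q ℕ.+ i)) * (m C i) × 1#)
    P : ℕ → Set ℓ
    P k′ = weightedOverlap d k′ q a
           ≈ msym₂₁ d m q a * (((d ∸ (m ℕ.+ q)) C q) × 1# * sumTo (suc m) (λ i → ι (lhsCoef k′ (q ℕ.+ i)) * (m C i) × 1#))

lemma5p5 : {c ℓ : Level} (R : CommutativeRing c ℓ) (ι : ℚ → CommutativeRing.Carrier R) →
    RingMorphisms.IsRingHomomorphism +-*-rawRing (CommutativeRing.rawRing R) ι →
    (d k : ℕ) → 0 < k → 2 ∣ k → k ≤ d →
    (a : Fin d → CommutativeRing.Carrier R) →
    let open CommutativeRing R
        open Sym R
    in sumR (map (λ l → ι (lhsCoef k l) *
                          sumSubsetsOfSize d k (λ S → eSub (k ∸ l) S a * eSub l S a))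
                 (range 0 k))
       ≈ sumR (map (λ q → msym (part2 k q) a * ι (rhsCoef d k q))
                   (range 0 (k / 2)))
lemma5p5 R ι ι-hom d k 0<k (divides h k≡h*2) k≤d a =
  trans (lhs≈sumTo-weightedOverlap d k a) (begin
    sumTo (suc d) W                    ≡⟨ ≡.cong (λ n → sumTo (suc n) W) (ℕ.m+[n∸m]≡n (ℕ.≤-trans h≤k k≤d)) ⟨
    sumTo (suc h ℕ.+ (d ∸ h)) W        ≈⟨ sumTo-dropSuffix (suc h) (d ∸ h) W (λ i _ →
                                            weightedOverlap-vanish d k (suc h ℕ.+ i) a (k<b+b (ℕ.m≤m+n (suc h) i))) ⟩
    sumTo (suc h) W                    ≈⟨ sumTo-cong< (suc h) (λ q q<1+h →
                                            weightedOverlap≈rhsTerm d k q a (2q≤k (ℕ.s≤s⁻¹ q<1+h)) (2≤k 0<k)) ⟩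
    sumTo (suc h) rhsTerm              ≡⟨ ≡.cong (λ n → sumTo (suc n) rhsTerm) k/2≡h ⟨
    sumTo (suc (k / 2)) rhsTerm        ≡⟨ sumOver-range rhsTerm 0 (k / 2) ⟨
    sumOver rhsTerm (range 0 (k / 2))  ∎)
  where
  open CommutativeRing R
  open Sym R
  open Sums R
  open WeightedOverlap R ι ι-hom
  open Halving {k} {h} k≡h*2
  open import Relation.Binary.Reasoning.Setoid setoid
  W : ℕ → Carrier
  W b = weightedOverlap d k b a
  rhsTerm : ℕ → Carrier
  rhsTerm q = msym (part2 k q) a * ι (rhsCoef d k q)
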